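{- Let $M \in \mathsf T_n$. Then, for each odd $k \in \{1,\dots,n\}$, \[ \mathsf c_k(\operatorname{Char}_M) = -\sum_{i=0}^{k-1}\binom{n-i}{n-k}\mathsf c_i(\operatorname{Char}_M). \] Furthermore, if in addition $n$ is odd, then for each odd $k\in\{1,\dots,n\}$, \[ (n-k+1)\mathsf c_{k-1}(\operatorname{Char}_M)+\sum_{i=0}^{k-2}\binom{n-i}{n-k}\mathsf c_i(\operatorname{Char}_M) \equiv 0 \pmod{2^{k-1}}. \]
   Context: $\mathsf T_n$ is the set of $n\times n$ matrices $M$ with entries in $\{1,-1\}$, all diagonal entries equal to $1$, and $(M-I)^\top=-(M-I)$. $\operatorname{Char}_M(x)=\det(xI-M)$, and $\mathsf c_k(p)$ denotes the coefficient of $x^{\deg p-k}$ in a polynomial $p$. -}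

module Defs where

open import Data.Nat as ℕ using (ℕ; zero; suc; _∸_)
open import Data.Integer as ℤ using (ℤ; +_; -_; _-_; 0ℤ; 1ℤ)
open import Data.Fin using (Fin; zero; suc; punchIn)
open import Data.List using (List; []; _∷_; map; length; foldr)
open import Data.Product using (∃; _×_)
open import Data.Sum using (_⊎_)
open import Relation.Binary.PropositionalEquality using (_≡_)
open import Relation.Nullary using (yes; no)
open import Data.Fin using () renaming (_≟_ to _≟ᶠ_)
open import Data.Integer using () renaming (_≟_ to _≟ℤ_)
open import Data.Bool using (Bool; true; false; if_then_else_)

Odd : ℕ → Set
Odd k = ∃ λ m → k ≡ suc (2 ℕ.* m)

Mat : ℕ → Set
Mat n = Fin n → Fin n → ℤ

δ : ∀ {n} → Fin n → Fin n → ℤ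
δ i j with i ≟ᶠ j
... | yes _ = 1ℤ
... | no  _ = 0ℤ

subI : ∀ {n} → Mat n → Mat n
subI M i j = M i j - δ i j

InT : (n : ℕ) → Mat n → Set
InT n M =
  (∀ i j → (M i j ≡ 1ℤ) ⊎ (M i j ≡ - 1ℤ)) ×
  (∀ i → M i i ≡ 1ℤ) ×
  (∀ i j → subI M j i ≡ - subI M i j)

-- Polynomials over ℤ as coefficient lists (index i = coefficient of x^i)

Poly : Set
Poly = List ℤ

_+ₚ_ : Poly → Poly → Poly
[] +ₚ q = q
(a ∷ p) +ₚ [] = a ∷ p
(a ∷ p) +ₚ (b ∷ q) = (a ℤ.+ b) ∷ (p +ₚ q)

negₚ : Poly → Poly
negₚ = map (λ a → - a)

_*ₚ_ : Poly → Poly → Poly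
[] *ₚ q = []
(a ∷ p) *ₚ q = map (a ℤ.*_) q +ₚ (0ℤ ∷ (p *ₚ q))

constₚ : ℤ → Poly
constₚ a = a ∷ []

Xₚ : Poly
Xₚ = 0ℤ ∷ 1ℤ ∷ []

isZero : ℤ → Bool
isZero a with a ≟ℤ 0ℤ
... | yes _ = true
... | no  _ = false

strip : Poly → Poly
strip [] = []
strip (a ∷ p) with strip p
... | [] = if isZero a then [] else (a ∷ [])
... | q ∷ qs = a ∷ q ∷ qs

-- degree (convention: deg 0 = 0)
deg : Poly → ℕ
deg p = length (strip p) ∸ 1

coeff : Poly → ℕ → ℤ
coeff [] m = 0ℤ
coeff (a ∷ p) zero = a
coeff (a ∷ p) (suc m) = coeff p m

c : ℕ → Poly → ℤ
c k p = coeff p (deg p ∸ k)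

sumFin : ∀ {n} → (Fin n → Poly) → Poly
sumFin {zero} f = []
sumFin {suc n} f = f zero +ₚ sumFin (λ j → f (suc j))

signₚ : ℕ → Poly → Poly
signₚ zero p = p
signₚ (suc zero) p = negₚ p
signₚ (suc (suc k)) p = signₚ k p

toℕ' : ∀ {n} → Fin n → ℕ
toℕ' zero = zero
toℕ' (suc i) = suc (toℕ' i)

det : ∀ {n} → (Fin n → Fin n → Poly) → Poly
det {zero} A = constₚ 1ℤ
det {suc n} A =
  sumFin (λ j → signₚ (toℕ' j) (A zero j *ₚ det (λ i k → A (suc i) (punchIn j k))))

Char : ∀ {n} → Mat n → Poly
Char M = det (λ i j → (constₚ (δ i j) *ₚ Xₚ) +ₚ negₚ (constₚ (M i j)))

Σ< : ℕ → (ℕ → ℤ) → ℤ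
Σ< zero f = 0ℤ
Σ< (suc m) f = Σ< m f ℤ.+ f m

{-# OPTIONS --safe #-}
-- Write P = Char M and S = M − I, which is skew-symmetric. Then P(X + 1) = det(XI − S) = Char S,
-- and transposing XI − S shows Char S (−X) = (−1)ⁿ Char S, so for odd k the coefficient of
-- X^(n−k) in P(X + 1) vanishes. By the binomial theorem that coefficient is
-- Σ_{i ≤ k} C(n−i, n−k) c_i(P), which is the recurrence. For the congruence, subtracting from each
-- row of XI − M the row above it leaves all rows but the first with even constant terms, so
-- P lies in the ideal (2, X)^(n−1) of ℤ[X]; that is, 2^(k−1) divides c_k(P), and by the
-- recurrence the left-hand side of the congruence is −c_k(P).
module Submission where

open import Defs
open import Data.Nat using (ℕ; _∸_; _≤_; _^_) renaming (_+_ to _+ℕ_)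
open import Data.Nat.Combinatorics using (_C_)
open import Data.Integer using (ℤ; +_; -_; _+_; _*_)
open import Data.Integer.Divisibility using (_∣_)
open import Data.Product using (_×_)
open import Relation.Binary.PropositionalEquality using (_≡_)

open import Algebra.Bundles using (CommutativeRing; AbelianGroup)
open import Algebra.Morphism.Structures using (module RingMorphisms)
open import Data.Bool using (false)
open import Data.Empty using (⊥-elim)
open import Data.Fin using (Fin; zero; suc; punchIn; inject₁) renaming (_≟_ to _≟ᶠ_)
open import Data.Fin.Properties using (suc-injective)
open import Data.Integer using (0ℤ; 1ℤ; -[1+_]) renaming (_^_ to _^ℤ_; _≟_ to _ℤ≟_)
import Data.Integer.Divisibility.Signed as DS
import Data.Integer.Properties as ℤP
open import Data.Integer.Tactic.RingSolver using () renaming (solve-∀ to ℤ-solve)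
open import Data.List using ([]; _∷_; map; length)
open import Data.Maybe using (nothing)
open import Data.Nat using (zero; suc; _<_; z≤n; s≤s) renaming (_*_ to _*ℕ_)
open import Data.Nat.Combinatorics using (nCk+nC[k+1]≡[n+1]C[k+1]; nCk≡nC[n∸k]; nCn≡1; nC1≡n; k>n⇒nCk≡0)
import Data.Nat.Properties as ℕP
open import Data.Product using (_,_; proj₁; proj₂)
open import Data.Sum using (_⊎_; inj₁; inj₂)
open import Function using (_∘_)
open import Level using (0ℓ)
open import Relation.Binary.Bundles using (Setoid)
open import Relation.Binary.PropositionalEquality
  using (_≢_; refl; sym; trans; cong; cong₂; subst; subst₂; module ≡-Reasoning)
import Relation.Binary.Reasoning.Setoid
open import Relation.Binary.Structures using (IsEquivalence)
open import Relation.Nullary using (Dec; yes; no)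
open import Tactic.RingSolver using (solve-∀)
open import Tactic.RingSolver.Core.AlmostCommutativeRing using (AlmostCommutativeRing; fromCommutativeRing)

open import Algebra.Properties.Group (AbelianGroup.group ℤP.+-0-abelianGroup)
  using () renaming (inverseˡ-unique to ℤ-inverseˡ-unique; inverseʳ-unique to ℤ-inverseʳ-unique)

-- Polynomials up to trailing zeros

infix 4 _≈_
record _≈_ (p q : Poly) : Set where
  constructor coeffwise
  field coeff-≈ : ∀ m → coeff p m ≡ coeff q m
open _≈_ public

≈-refl : ∀ {p} → p ≈ p
≈-refl = coeffwise λ _ → refl

≈-sym : ∀ {p q} → p ≈ q → q ≈ p
≈-sym e = coeffwise λ m → sym (coeff-≈ e m)

≈-trans : ∀ {p q r} → p ≈ q → q ≈ r → p ≈ r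
≈-trans e f = coeffwise λ m → trans (coeff-≈ e m) (coeff-≈ f m)

≈-isEquivalence : IsEquivalence _≈_
≈-isEquivalence = record { refl = ≈-refl ; sym = ≈-sym ; trans = ≈-trans }

≈-setoid : Setoid 0ℓ 0ℓ
≈-setoid = record { isEquivalence = ≈-isEquivalence }

module ≈-Reasoning = Relation.Binary.Reasoning.Setoid ≈-setoid

coeff-+ₚ : ∀ p q m → coeff (p +ₚ q) m ≡ coeff p m + coeff q m
coeff-+ₚ []      q       m       = sym (ℤP.+-identityˡ _)
coeff-+ₚ (a ∷ p) []      m       = sym (ℤP.+-identityʳ _)
coeff-+ₚ (a ∷ p) (b ∷ q) zero    = refl
coeff-+ₚ (a ∷ p) (b ∷ q) (suc m) = coeff-+ₚ p q m

coeff-negₚ : ∀ p m → coeff (negₚ p) m ≡ - coeff p m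
coeff-negₚ []      m       = refl
coeff-negₚ (a ∷ p) zero    = refl
coeff-negₚ (a ∷ p) (suc m) = coeff-negₚ p m

infixr 25 _·_
_·_ : ℤ → Poly → Poly
a · p = map (a *_) p

coeff-· : ∀ a p m → coeff (a · p) m ≡ a * coeff p m
coeff-· a []      m       = sym (ℤP.*-zeroʳ a)
coeff-· a (b ∷ p) zero    = refl
coeff-· a (b ∷ p) (suc m) = coeff-· a p m

∷-cong : ∀ {a b p q} → a ≡ b → p ≈ q → a ∷ p ≈ b ∷ q
∷-cong a≡b p≈q = coeffwise λ { zero → a≡b ; (suc m) → coeff-≈ p≈q m }

∷-injectiveʳ : ∀ {a b p q} → a ∷ p ≈ b ∷ q → p ≈ q
∷-injectiveʳ e = coeffwise λ m → coeff-≈ e (suc m)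

∷≈[]⇒≈[] : ∀ {a p} → a ∷ p ≈ [] → p ≈ []
∷≈[]⇒≈[] e = coeffwise λ m → coeff-≈ e (suc m)

+ₚ-cong : ∀ {p p′ q q′} → p ≈ p′ → q ≈ q′ → p +ₚ q ≈ p′ +ₚ q′
+ₚ-cong {p} {p′} {q} {q′} e f = coeffwise λ m → begin
  coeff (p +ₚ q) m        ≡⟨ coeff-+ₚ p q m ⟩
  coeff p m + coeff q m   ≡⟨ cong₂ _+_ (coeff-≈ e m) (coeff-≈ f m) ⟩
  coeff p′ m + coeff q′ m ≡⟨ coeff-+ₚ p′ q′ m ⟨
  coeff (p′ +ₚ q′) m      ∎
  where open ≡-Reasoning

negₚ-cong : ∀ {p q} → p ≈ q → negₚ p ≈ negₚ q
negₚ-cong {p} {q} e = coeffwise λ m →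
  trans (coeff-negₚ p m) (trans (cong -_ (coeff-≈ e m)) (sym (coeff-negₚ q m)))

·-cong : ∀ {a b p q} → a ≡ b → p ≈ q → a · p ≈ b · q
·-cong {a} {b} {p} {q} a≡b e = coeffwise λ m →
  trans (coeff-· a p m) (trans (cong₂ _*_ a≡b (coeff-≈ e m)) (sym (coeff-· b q m)))

coeff-*ₚ-zero : ∀ a p q → coeff ((a ∷ p) *ₚ q) zero ≡ a * coeff q zero
coeff-*ₚ-zero a p q = begin
  coeff ((a ∷ p) *ₚ q) zero       ≡⟨ coeff-+ₚ (a · q) (0ℤ ∷ (p *ₚ q)) zero ⟩
  coeff (a · q) zero + 0ℤ         ≡⟨ ℤP.+-identityʳ _ ⟩
  coeff (a · q) zero              ≡⟨ coeff-· a q zero ⟩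
  a * coeff q zero                ∎
  where open ≡-Reasoning

coeff-*ₚ-suc : ∀ a p q m →
  coeff ((a ∷ p) *ₚ q) (suc m) ≡ a * coeff q (suc m) + coeff (p *ₚ q) m
coeff-*ₚ-suc a p q m =
  trans (coeff-+ₚ (a · q) (0ℤ ∷ (p *ₚ q)) (suc m)) (cong (_+ coeff (p *ₚ q) m) (coeff-· a q (suc m)))

≈[]⇒*ₚ≈[] : ∀ {p} q → p ≈ [] → p *ₚ q ≈ []
≈[]⇒*ₚ≈[] {[]}    q e = ≈-refl
≈[]⇒*ₚ≈[] {a ∷ p} q e = coeffwise λ where
  zero    → trans (coeff-*ₚ-zero a p q) (cong (_* coeff q zero) (coeff-≈ e zero))
  (suc m) → trans (coeff-*ₚ-suc a p q m)
                  (cong₂ _+_ (cong (_* coeff q (suc m)) (coeff-≈ e zero))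
                             (coeff-≈ (≈[]⇒*ₚ≈[] q (∷≈[]⇒≈[] e)) m))

*ₚ-zeroʳ : ∀ p → p *ₚ [] ≈ []
*ₚ-zeroʳ []      = ≈-refl
*ₚ-zeroʳ (a ∷ p) = coeffwise λ { zero → refl ; (suc m) → coeff-≈ (*ₚ-zeroʳ p) m }

*ₚ-congʳ : ∀ {p p′} q → p ≈ p′ → p *ₚ q ≈ p′ *ₚ q
*ₚ-congʳ {[]}    {[]}     q e = ≈-refl
*ₚ-congʳ {[]}    {b ∷ p′} q e = ≈-sym (≈[]⇒*ₚ≈[] q (≈-sym e))
*ₚ-congʳ {a ∷ p} {[]}     q e = ≈[]⇒*ₚ≈[] q e
*ₚ-congʳ {a ∷ p} {b ∷ p′} q e =
  +ₚ-cong (·-cong (coeff-≈ e zero) ≈-refl) (∷-cong refl (*ₚ-congʳ q (∷-injectiveʳ e)))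

+ₚ-comm : ∀ p q → p +ₚ q ≈ q +ₚ p
+ₚ-comm p q = coeffwise λ m →
  trans (coeff-+ₚ p q m) (trans (ℤP.+-comm (coeff p m) (coeff q m)) (sym (coeff-+ₚ q p m)))

+ₚ-assoc : ∀ p q r → (p +ₚ q) +ₚ r ≈ p +ₚ (q +ₚ r)
+ₚ-assoc p q r = coeffwise λ m → begin
  coeff ((p +ₚ q) +ₚ r) m                 ≡⟨ coeff-+ₚ (p +ₚ q) r m ⟩
  coeff (p +ₚ q) m + coeff r m            ≡⟨ cong (_+ coeff r m) (coeff-+ₚ p q m) ⟩
  (coeff p m + coeff q m) + coeff r m     ≡⟨ ℤP.+-assoc (coeff p m) (coeff q m) (coeff r m) ⟩
  coeff p m + (coeff q m + coeff r m)     ≡⟨ cong (_+_ (coeff p m)) (coeff-+ₚ q r m) ⟨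
  coeff p m + coeff (q +ₚ r) m            ≡⟨ coeff-+ₚ p (q +ₚ r) m ⟨
  coeff (p +ₚ (q +ₚ r)) m                 ∎
  where open ≡-Reasoning

+ₚ-identityʳ : ∀ p → p +ₚ [] ≈ p
+ₚ-identityʳ p = coeffwise λ m → trans (coeff-+ₚ p [] m) (ℤP.+-identityʳ _)

negₚ-inverseˡ : ∀ p → negₚ p +ₚ p ≈ []
negₚ-inverseˡ p = coeffwise λ m →
  trans (coeff-+ₚ (negₚ p) p m) (trans (cong (_+ coeff p m) (coeff-negₚ p m)) (ℤP.+-inverseˡ (coeff p m)))

negₚ-inverseʳ : ∀ p → p +ₚ negₚ p ≈ []
negₚ-inverseʳ p = ≈-trans (+ₚ-comm p (negₚ p)) (negₚ-inverseˡ p)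

+ₚ-interchange : ∀ x y z w → (x +ₚ y) +ₚ (z +ₚ w) ≈ (x +ₚ z) +ₚ (y +ₚ w)
+ₚ-interchange x y z w = coeffwise λ m → begin
  coeff ((x +ₚ y) +ₚ (z +ₚ w)) m                    ≡⟨ coeff-+ₚ (x +ₚ y) (z +ₚ w) m ⟩
  coeff (x +ₚ y) m + coeff (z +ₚ w) m               ≡⟨ cong₂ _+_ (coeff-+ₚ x y m) (coeff-+ₚ z w m) ⟩
  (coeff x m + coeff y m) + (coeff z m + coeff w m) ≡⟨ ℤ-interchange (coeff x m) _ _ _ ⟩
  (coeff x m + coeff z m) + (coeff y m + coeff w m) ≡⟨ cong₂ _+_ (coeff-+ₚ x z m) (coeff-+ₚ y w m) ⟨
  coeff (x +ₚ z) m + coeff (y +ₚ w) m               ≡⟨ coeff-+ₚ (x +ₚ z) (y +ₚ w) m ⟨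
  coeff ((x +ₚ z) +ₚ (y +ₚ w)) m                    ∎
  where
  open ≡-Reasoning
  ℤ-interchange : ∀ x y z w → (x + y) + (z + w) ≡ (x + z) + (y + w)
  ℤ-interchange = ℤ-solve

·-distribˡ-+ₚ : ∀ a p q → a · (p +ₚ q) ≈ a · p +ₚ a · q
·-distribˡ-+ₚ a p q = coeffwise λ m → begin
  coeff (a · (p +ₚ q)) m                 ≡⟨ coeff-· a (p +ₚ q) m ⟩
  a * coeff (p +ₚ q) m                   ≡⟨ cong (a *_) (coeff-+ₚ p q m) ⟩
  a * (coeff p m + coeff q m)            ≡⟨ ℤP.*-distribˡ-+ a (coeff p m) (coeff q m) ⟩
  a * coeff p m + a * coeff q m          ≡⟨ cong₂ _+_ (coeff-· a p m) (coeff-· a q m) ⟨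
  coeff (a · p) m + coeff (a · q) m      ≡⟨ coeff-+ₚ (a · p) (a · q) m ⟨
  coeff (a · p +ₚ a · q) m               ∎
  where open ≡-Reasoning

·-distribʳ-+ : ∀ a b q → (a + b) · q ≈ a · q +ₚ b · q
·-distribʳ-+ a b []      = ≈-refl
·-distribʳ-+ a b (c ∷ q) = ∷-cong (ℤP.*-distribʳ-+ c a b) (·-distribʳ-+ a b q)

·-zeroˡ : ∀ q → 0ℤ · q ≈ []
·-zeroˡ []      = ≈-refl
·-zeroˡ (c ∷ q) = coeffwise λ { zero → refl ; (suc m) → coeff-≈ (·-zeroˡ q) m }

·-identityˡ : ∀ q → 1ℤ · q ≈ q
·-identityˡ []      = ≈-refl
·-identityˡ (c ∷ q) = ∷-cong (ℤP.*-identityˡ c) (·-identityˡ q)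

·-assoc : ∀ a b q → a · b · q ≈ (a * b) · q
·-assoc a b []      = ≈-refl
·-assoc a b (c ∷ q) = ∷-cong (sym (ℤP.*-assoc a b c)) (·-assoc a b q)

*ₚ-distribʳ-+ₚ : ∀ q p p′ → (p +ₚ p′) *ₚ q ≈ (p *ₚ q) +ₚ (p′ *ₚ q)
*ₚ-distribʳ-+ₚ q []      p′       = ≈-refl
*ₚ-distribʳ-+ₚ q (a ∷ p) []       = ≈-sym (+ₚ-identityʳ _)
*ₚ-distribʳ-+ₚ q (a ∷ p) (b ∷ p′) = begin
  (a + b) · q +ₚ (0ℤ ∷ (p +ₚ p′) *ₚ q)
    ≈⟨ +ₚ-cong (·-distribʳ-+ a b q) (∷-cong refl (*ₚ-distribʳ-+ₚ q p p′)) ⟩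
  (a · q +ₚ b · q) +ₚ ((0ℤ ∷ p *ₚ q) +ₚ (0ℤ ∷ p′ *ₚ q))
    ≈⟨ +ₚ-interchange (a · q) (b · q) _ _ ⟩
  (a · q +ₚ (0ℤ ∷ p *ₚ q)) +ₚ (b · q +ₚ (0ℤ ∷ p′ *ₚ q)) ∎
  where open ≈-Reasoning

*ₚ-distribˡ-+ₚ : ∀ q p p′ → q *ₚ (p +ₚ p′) ≈ (q *ₚ p) +ₚ (q *ₚ p′)
*ₚ-distribˡ-+ₚ []      p p′ = ≈-refl
*ₚ-distribˡ-+ₚ (a ∷ q) p p′ = begin
  a · (p +ₚ p′) +ₚ (0ℤ ∷ q *ₚ (p +ₚ p′))
    ≈⟨ +ₚ-cong (·-distribˡ-+ₚ a p p′) (∷-cong refl (*ₚ-distribˡ-+ₚ q p p′)) ⟩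
  (a · p +ₚ a · p′) +ₚ ((0ℤ ∷ q *ₚ p) +ₚ (0ℤ ∷ q *ₚ p′))
    ≈⟨ +ₚ-interchange (a · p) (a · p′) _ _ ⟩
  (a · p +ₚ (0ℤ ∷ q *ₚ p)) +ₚ (a · p′ +ₚ (0ℤ ∷ q *ₚ p′)) ∎
  where open ≈-Reasoning

*ₚ-∷ʳ : ∀ p b q → p *ₚ (b ∷ q) ≈ b · p +ₚ (0ℤ ∷ p *ₚ q)
*ₚ-∷ʳ []      b q = coeffwise λ { zero → refl ; (suc m) → refl }
*ₚ-∷ʳ (a ∷ p) b q = begin
  a · (b ∷ q) +ₚ (0ℤ ∷ p *ₚ (b ∷ q))
    ≈⟨ +ₚ-cong (≈-refl {a · (b ∷ q)}) (∷-cong refl (*ₚ-∷ʳ p b q)) ⟩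
  (a * b ∷ a · q) +ₚ (0ℤ ∷ b · p +ₚ (0ℤ ∷ p *ₚ q))
    ≈⟨ ∷-cong (cong (_+ 0ℤ) (ℤP.*-comm a b)) (swap-front (a · q) (b · p) (0ℤ ∷ p *ₚ q)) ⟩
  (b * a ∷ b · p) +ₚ (0ℤ ∷ a · q +ₚ (0ℤ ∷ p *ₚ q)) ∎
  where
  open ≈-Reasoning
  swap-front : ∀ x y z → x +ₚ (y +ₚ z) ≈ y +ₚ (x +ₚ z)
  swap-front x y z =
    ≈-trans (≈-sym (+ₚ-assoc x y z)) (≈-trans (+ₚ-cong (+ₚ-comm x y) ≈-refl) (+ₚ-assoc y x z))

*ₚ-comm : ∀ p q → p *ₚ q ≈ q *ₚ p
*ₚ-comm []      q = ≈-sym (*ₚ-zeroʳ q)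
*ₚ-comm (a ∷ p) q = ≈-trans (+ₚ-cong ≈-refl (∷-cong refl (*ₚ-comm p q))) (≈-sym (*ₚ-∷ʳ q a p))

*ₚ-congˡ : ∀ q {p p′} → p ≈ p′ → q *ₚ p ≈ q *ₚ p′
*ₚ-congˡ q {p} {p′} e = ≈-trans (*ₚ-comm q p) (≈-trans (*ₚ-congʳ q e) (*ₚ-comm p′ q))

·-*ₚ : ∀ a p q → (a · p) *ₚ q ≈ a · (p *ₚ q)
·-*ₚ a []      q = ≈-refl
·-*ₚ a (b ∷ p) q = begin
  (a * b) · q +ₚ (0ℤ ∷ (a · p) *ₚ q)
    ≈⟨ +ₚ-cong (≈-sym (·-assoc a b q)) (∷-cong (sym (ℤP.*-zeroʳ a)) (·-*ₚ a p q)) ⟩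
  a · b · q +ₚ a · (0ℤ ∷ p *ₚ q)
    ≈⟨ ≈-sym (·-distribˡ-+ₚ a (b · q) (0ℤ ∷ p *ₚ q)) ⟩
  a · (b · q +ₚ (0ℤ ∷ p *ₚ q)) ∎
  where open ≈-Reasoning

0∷-*ₚ : ∀ p q → (0ℤ ∷ p) *ₚ q ≈ (0ℤ ∷ p *ₚ q)
0∷-*ₚ p q = +ₚ-cong (·-zeroˡ q) ≈-refl

*ₚ-assoc : ∀ p q r → (p *ₚ q) *ₚ r ≈ p *ₚ (q *ₚ r)
*ₚ-assoc []      q r = ≈-refl
*ₚ-assoc (a ∷ p) q r = begin
  (a · q +ₚ (0ℤ ∷ p *ₚ q)) *ₚ r
    ≈⟨ *ₚ-distribʳ-+ₚ r (a · q) _ ⟩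
  ((a · q) *ₚ r) +ₚ ((0ℤ ∷ p *ₚ q) *ₚ r)
    ≈⟨ +ₚ-cong (·-*ₚ a q r) (≈-trans (0∷-*ₚ (p *ₚ q) r) (∷-cong refl (*ₚ-assoc p q r))) ⟩
  a · (q *ₚ r) +ₚ (0ℤ ∷ p *ₚ (q *ₚ r)) ∎
  where open ≈-Reasoning

constₚ-*ₚ : ∀ a q → constₚ a *ₚ q ≈ a · q
constₚ-*ₚ a q = ≈-trans (+ₚ-cong (≈-refl {a · q}) (coeffwise λ { zero → refl ; (suc m) → refl }))
                        (+ₚ-identityʳ (a · q))

*ₚ-identityˡ : ∀ q → constₚ 1ℤ *ₚ q ≈ q
*ₚ-identityˡ q = ≈-trans (constₚ-*ₚ 1ℤ q) (·-identityˡ q)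

*ₚ-identityʳ : ∀ q → q *ₚ constₚ 1ℤ ≈ q
*ₚ-identityʳ q = ≈-trans (*ₚ-comm q _) (*ₚ-identityˡ q)

polyRing : CommutativeRing 0ℓ 0ℓ
polyRing = record
  { Carrier = Poly ; _≈_ = _≈_ ; _+_ = _+ₚ_ ; _*_ = _*ₚ_ ; -_ = negₚ ; 0# = [] ; 1# = constₚ 1ℤ
  ; isCommutativeRing = record
    { isRing = record
      { +-isAbelianGroup = record
        { isGroup = record
          { isMonoid = record
            { isSemigroup = record
              { isMagma = record { isEquivalence = ≈-isEquivalence ; ∙-cong = +ₚ-cong }
              ; assoc = +ₚ-assoc }
            ; identity = (λ _ → ≈-refl) , +ₚ-identityʳ }
          ; inverse = negₚ-inverseˡ , negₚ-inverseʳ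
          ; ⁻¹-cong = negₚ-cong }
        ; comm = +ₚ-comm }
      ; *-cong = λ {p} {p′} {q} {q′} e f → ≈-trans (*ₚ-congʳ q e) (*ₚ-congˡ p′ f)
      ; *-assoc = *ₚ-assoc
      ; *-identity = *ₚ-identityˡ , *ₚ-identityʳ
      ; distrib = *ₚ-distribˡ-+ₚ , *ₚ-distribʳ-+ₚ }
    ; *-comm = *ₚ-comm } }

open CommutativeRing polyRing using (*-cong)

IsPolyRingHomomorphism : (Poly → Poly) → Set
IsPolyRingHomomorphism =
  RingMorphisms.IsRingHomomorphism (CommutativeRing.rawRing polyRing) (CommutativeRing.rawRing polyRing)

polyAlmostCommRing : AlmostCommutativeRing 0ℓ 0ℓ
polyAlmostCommRing = fromCommutativeRing polyRing (λ _ → nothing)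

sumFin-cong : ∀ {n} {f g : Fin n → Poly} → (∀ j → f j ≈ g j) → sumFin f ≈ sumFin g
sumFin-cong {zero}  e = ≈-refl
sumFin-cong {suc n} e = +ₚ-cong (e zero) (sumFin-cong {n} (λ j → e (suc j)))

sumFin-zero : ∀ {n} (f : Fin n → Poly) → (∀ j → f j ≈ []) → sumFin f ≈ []
sumFin-zero {zero}  f e = ≈-refl
sumFin-zero {suc n} f e = +ₚ-cong (e zero) (sumFin-zero {n} (λ j → f (suc j)) (λ j → e (suc j)))

sumFin-+ₚ : ∀ {n} (f g : Fin n → Poly) → sumFin (λ j → f j +ₚ g j) ≈ sumFin f +ₚ sumFin g
sumFin-+ₚ {zero}  f g = ≈-refl
sumFin-+ₚ {suc n} f g = ≈-trans (+ₚ-cong ≈-refl (sumFin-+ₚ {n} (λ j → f (suc j)) (λ j → g (suc j))))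
                                (+ₚ-interchange (f zero) (g zero) _ _)

sumFin-negₚ : ∀ {n} (f : Fin n → Poly) → sumFin (λ j → negₚ (f j)) ≈ negₚ (sumFin f)
sumFin-negₚ {zero}  f = ≈-refl
sumFin-negₚ {suc n} f = ≈-trans (+ₚ-cong ≈-refl (sumFin-negₚ {n} (λ j → f (suc j)))) (neg-+ (f zero) _)
  where
  neg-+ : ∀ a b → negₚ a +ₚ negₚ b ≈ negₚ (a +ₚ b)
  neg-+ = solve-∀ polyAlmostCommRing

*ₚ-distribˡ-sumFin : ∀ {n} r (f : Fin n → Poly) → r *ₚ sumFin f ≈ sumFin (λ j → r *ₚ f j)
*ₚ-distribˡ-sumFin {zero}  r f = *ₚ-zeroʳ r
*ₚ-distribˡ-sumFin {suc n} r f =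
  ≈-trans (*ₚ-distribˡ-+ₚ r (f zero) _) (+ₚ-cong ≈-refl (*ₚ-distribˡ-sumFin {n} r (λ j → f (suc j))))

sumFin-comm : ∀ {m n} (f : Fin m → Fin n → Poly) →
  sumFin (λ i → sumFin (λ j → f i j)) ≈ sumFin (λ j → sumFin (λ i → f i j))
sumFin-comm {zero} {n} f = ≈-sym (sumFin-zero {n} _ (λ _ → ≈-refl))
sumFin-comm {suc m} {n} f = ≈-trans (+ₚ-cong ≈-refl (sumFin-comm {m} (λ i → f (suc i))))
                                (≈-sym (sumFin-+ₚ {n} (f zero) _))

±ₚ : ℕ → Poly
±ₚ k = constₚ ((- 1ℤ) ^ℤ k)

coeff-signₚ : ∀ k p m → coeff (signₚ k p) m ≡ (- 1ℤ) ^ℤ k * coeff p m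
coeff-signₚ zero          p m = sym (ℤP.*-identityˡ _)
coeff-signₚ (suc zero)    p m = trans (coeff-negₚ p m) (sym (ℤP.-1*i≡-i (coeff p m)))
coeff-signₚ (suc (suc k)) p m = trans (coeff-signₚ k p m) (cong (_* coeff p m) (sym (-1*-1*i≡i ((- 1ℤ) ^ℤ k))))
  where
  -1*-1*i≡i : ∀ i → - 1ℤ * (- 1ℤ * i) ≡ i
  -1*-1*i≡i i = trans (ℤP.-1*i≡-i _) (trans (cong -_ (ℤP.-1*i≡-i i)) (ℤP.neg-involutive i))

signₚ≈±ₚ*ₚ : ∀ k p → signₚ k p ≈ ±ₚ k *ₚ p
signₚ≈±ₚ*ₚ k p = coeffwise λ m → begin
  coeff (signₚ k p) m            ≡⟨ coeff-signₚ k p m ⟩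
  (- 1ℤ) ^ℤ k * coeff p m        ≡⟨ coeff-· ((- 1ℤ) ^ℤ k) p m ⟨
  coeff (((- 1ℤ) ^ℤ k) · p) m     ≡⟨ coeff-≈ (constₚ-*ₚ ((- 1ℤ) ^ℤ k) p) m ⟨
  coeff (±ₚ k *ₚ p) m            ∎
  where open ≡-Reasoning

±ₚ-suc : ∀ k → ±ₚ (suc k) ≈ negₚ (±ₚ k)
±ₚ-suc k = ∷-cong (ℤP.-1*i≡-i _) ≈-refl

signₚ-cong : ∀ k {p q} → p ≈ q → signₚ k p ≈ signₚ k q
signₚ-cong k {p} {q} e =
  ≈-trans (signₚ≈±ₚ*ₚ k p) (≈-trans (*ₚ-congˡ (±ₚ k) e) (≈-sym (signₚ≈±ₚ*ₚ k q)))

signedSum : ∀ {n} → (Fin n → Poly) → Poly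
signedSum f = sumFin (λ j → signₚ (toℕ' j) (f j))

signedSum≈sum : ∀ {n} (f : Fin n → Poly) → signedSum f ≈ sumFin (λ j → ±ₚ (toℕ' j) *ₚ f j)
signedSum≈sum f = sumFin-cong (λ j → signₚ≈±ₚ*ₚ (toℕ' j) (f j))

signedSum-cong : ∀ {n} {f g : Fin n → Poly} → (∀ j → f j ≈ g j) → signedSum f ≈ signedSum g
signedSum-cong e = sumFin-cong (λ j → signₚ-cong (toℕ' j) (e j))

signedSum-+ₚ : ∀ {n} (f g : Fin n → Poly) → signedSum (λ j → f j +ₚ g j) ≈ signedSum f +ₚ signedSum g
signedSum-+ₚ {n} f g = ≈-trans (signedSum≈sum (λ j → f j +ₚ g j)) (≈-trans
  (sumFin-cong {n} λ j → *ₚ-distribˡ-+ₚ (±ₚ (toℕ' j)) (f j) (g j))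
  (≈-trans (sumFin-+ₚ (λ j → ±ₚ (toℕ' j) *ₚ f j) (λ j → ±ₚ (toℕ' j) *ₚ g j))
           (≈-sym (+ₚ-cong (signedSum≈sum f) (signedSum≈sum g)))))

signedSum-scale : ∀ {n} r (f : Fin n → Poly) → signedSum (λ j → r *ₚ f j) ≈ r *ₚ signedSum f
signedSum-scale {n} r f = ≈-trans (signedSum≈sum (λ j → r *ₚ f j)) (≈-trans
  (sumFin-cong {n} λ j → swap (±ₚ (toℕ' j)) r (f j))
  (≈-sym (≈-trans (*ₚ-congˡ r (signedSum≈sum f)) (*ₚ-distribˡ-sumFin r (λ j → ±ₚ (toℕ' j) *ₚ f j)))))
  where
  swap : ∀ s r x → s *ₚ (r *ₚ x) ≈ r *ₚ (s *ₚ x)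
  swap = solve-∀ polyAlmostCommRing

signedSum-zero : ∀ {n} (f : Fin n → Poly) → (∀ j → f j ≈ []) → signedSum f ≈ []
signedSum-zero {n} f e = ≈-trans (signedSum≈sum f)
  (sumFin-zero {n} _ λ j → ≈-trans (*ₚ-congˡ (±ₚ (toℕ' j)) (e j)) (*ₚ-zeroʳ (±ₚ (toℕ' j))))

signedSum-linear : ∀ {n} r (f g h : Fin n → Poly) → (∀ j → h j ≈ f j +ₚ (r *ₚ g j)) →
  signedSum h ≈ signedSum f +ₚ (r *ₚ signedSum g)
signedSum-linear r f g h e = ≈-trans (signedSum-cong e)
  (≈-trans (signedSum-+ₚ f _) (+ₚ-cong ≈-refl (signedSum-scale r g)))

signedSum-shift : ∀ {n} (f : Fin n → Poly) →
  sumFin (λ j → signₚ (suc (toℕ' j)) (f j)) ≈ negₚ (signedSum f)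
signedSum-shift {n} f = ≈-trans
  (sumFin-cong {n} λ j → ≈-trans (signₚ≈±ₚ*ₚ (suc (toℕ' j)) (f j))
                      (≈-trans (*-cong (±ₚ-suc (toℕ' j)) ≈-refl) (neg-out (±ₚ (toℕ' j)) (f j))))
  (≈-trans (sumFin-negₚ (λ j → ±ₚ (toℕ' j) *ₚ f j)) (negₚ-cong (≈-sym (signedSum≈sum f))))
  where
  neg-out : ∀ s x → negₚ s *ₚ x ≈ negₚ (s *ₚ x)
  neg-out = solve-∀ polyAlmostCommRing

signedSum-nested : ∀ {m n} (x : Fin m → Poly) (y : Fin n → Poly) (D : Fin n → Fin m → Poly) →
  signedSum (λ j → x j *ₚ signedSum (λ i → y i *ₚ D i j)) ≈
  sumFin (λ j → sumFin (λ i → ((±ₚ (toℕ' j) *ₚ ±ₚ (toℕ' i)) *ₚ (x j *ₚ y i)) *ₚ D i j))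
signedSum-nested {m} {n} x y D = ≈-trans (signedSum≈sum {m} _) (sumFin-cong {m} λ j → begin
  σ j *ₚ (x j *ₚ signedSum (λ i → y i *ₚ D i j))
    ≈⟨ *ₚ-congˡ (σ j) (*ₚ-congˡ (x j) (signedSum≈sum {n} _)) ⟩
  σ j *ₚ (x j *ₚ sumFin (λ i → σ i *ₚ (y i *ₚ D i j)))
    ≈⟨ ≈-trans (*ₚ-congˡ (σ j) (*ₚ-distribˡ-sumFin {n} (x j) _)) (*ₚ-distribˡ-sumFin {n} (σ j) _) ⟩
  sumFin (λ i → σ j *ₚ (x j *ₚ (σ i *ₚ (y i *ₚ D i j))))
    ≈⟨ sumFin-cong {n} (λ i → regroup (σ j) (σ i) (x j) (y i) (D i j)) ⟩
  sumFin (λ i → ((σ j *ₚ σ i) *ₚ (x j *ₚ y i)) *ₚ D i j) ∎)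
  where
  open ≈-Reasoning
  σ : ∀ {k} → Fin k → Poly
  σ l = ±ₚ (toℕ' l)
  regroup : ∀ s t a b d → s *ₚ (a *ₚ (t *ₚ (b *ₚ d))) ≈ ((s *ₚ t) *ₚ (a *ₚ b)) *ₚ d
  regroup = solve-∀ polyAlmostCommRing

signedSum-comm : ∀ {m n} (x : Fin m → Poly) (y : Fin n → Poly) (D : Fin n → Fin m → Poly) →
  signedSum (λ j → x j *ₚ signedSum (λ i → y i *ₚ D i j)) ≈
  signedSum (λ i → y i *ₚ signedSum (λ j → x j *ₚ D i j))
signedSum-comm {m} {n} x y D = begin
  signedSum (λ j → x j *ₚ signedSum (λ i → y i *ₚ D i j))
    ≈⟨ signedSum-nested x y D ⟩
  sumFin (λ j → sumFin (λ i → ((σ j *ₚ σ i) *ₚ (x j *ₚ y i)) *ₚ D i j))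
    ≈⟨ sumFin-comm {m} {n} _ ⟩
  sumFin (λ i → sumFin (λ j → ((σ j *ₚ σ i) *ₚ (x j *ₚ y i)) *ₚ D i j))
    ≈⟨ sumFin-cong {n} (λ i → sumFin-cong {m} λ j →
         *-cong (*-cong (*ₚ-comm (σ j) (σ i)) (*ₚ-comm (x j) (y i))) ≈-refl) ⟩
  sumFin (λ i → sumFin (λ j → ((σ i *ₚ σ j) *ₚ (y i *ₚ x j)) *ₚ D i j))
    ≈⟨ signedSum-nested y x (λ j i → D i j) ⟨
  signedSum (λ i → y i *ₚ signedSum (λ j → x j *ₚ D i j)) ∎
  where
  open ≈-Reasoning
  σ : ∀ {k} → Fin k → Poly
  σ l = ±ₚ (toℕ' l)

-- Determinants

PolyMat : ℕ → Set
PolyMat n = Fin n → Fin n → Poly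

minor : ∀ {n} → PolyMat (suc n) → Fin (suc n) → PolyMat n
minor A j i k = A (suc i) (punchIn j k)

infix 10 _ᵀ
_ᵀ : ∀ {n} → PolyMat n → PolyMat n
(A ᵀ) i j = A j i

det-cong : ∀ {n} {A B : PolyMat n} → (∀ i j → A i j ≈ B i j) → det A ≈ det B
det-cong {zero}  e = ≈-refl
det-cong {suc n} e = signedSum-cong λ j → *-cong (e zero j) (det-cong (λ i k → e (suc i) (punchIn j k)))

det-expandColumn : ∀ {n} (A : PolyMat (suc n)) →
  det A ≈ signedSum (λ i → A i zero *ₚ det (minor (A ᵀ) i ᵀ))
det-expandColumn {zero}  A = ≈-refl
det-expandColumn {suc n} A = +ₚ-cong (≈-refl {A zero zero *ₚ det (minor A zero)}) (begin
  sumFin (λ j → signₚ (suc (toℕ' j)) (A zero (suc j) *ₚ det (minor A (suc j))))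
    ≈⟨ signedSum-shift (λ j → A zero (suc j) *ₚ det (minor A (suc j))) ⟩
  negₚ (signedSum (λ j → A zero (suc j) *ₚ det (minor A (suc j))))
    ≈⟨ negₚ-cong (signedSum-cong λ j → *ₚ-congˡ (A zero (suc j)) (det-expandColumn (minor A (suc j)))) ⟩
  negₚ (signedSum (λ j → A zero (suc j) *ₚ signedSum (λ i → A (suc i) zero *ₚ det (D i j))))
    ≈⟨ negₚ-cong (signedSum-comm (λ j → A zero (suc j)) (λ i → A (suc i) zero) (λ i j → det (D i j))) ⟩
  negₚ (signedSum (λ i → A (suc i) zero *ₚ signedSum (λ j → A zero (suc j) *ₚ det (D i j))))
    ≈⟨ signedSum-shift (λ i → A (suc i) zero *ₚ det (minor (A ᵀ) (suc i) ᵀ)) ⟨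
  sumFin (λ i → signₚ (suc (toℕ' i)) (A (suc i) zero *ₚ det (minor (A ᵀ) (suc i) ᵀ))) ∎)
  where
  open ≈-Reasoning
  D : Fin (suc n) → Fin (suc n) → PolyMat n
  D i j r s = A (suc (punchIn i r)) (suc (punchIn j s))

det-transpose : ∀ {n} (A : PolyMat n) → det (A ᵀ) ≈ det A
det-transpose {zero}  A = ≈-refl
det-transpose {suc n} A = ≈-trans
  (signedSum-cong λ j → *ₚ-congˡ (A j zero) (≈-sym (det-transpose (minor (A ᵀ) j))))
  (≈-sym (det-expandColumn A))

det-negate : ∀ {n} (A : PolyMat n) → det (λ i j → negₚ (A i j)) ≈ signₚ n (det A)
det-negate {zero}  A = ≈-refl
det-negate {suc n} A = begin
  signedSum (λ j → negₚ (A zero j) *ₚ det (λ r s → negₚ (minor A j r s)))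
    ≈⟨ signedSum-cong (λ j → ≈-trans
         (*ₚ-congˡ (negₚ (A zero j)) (≈-trans (det-negate (minor A j)) (signₚ≈±ₚ*ₚ n _)))
         (≈-trans (neg-inside (A zero j) (±ₚ n) _) (*-cong (≈-sym (±ₚ-suc n)) ≈-refl))) ⟩
  signedSum (λ j → ±ₚ (suc n) *ₚ (A zero j *ₚ det (minor A j)))
    ≈⟨ signedSum-scale (±ₚ (suc n)) (λ j → A zero j *ₚ det (minor A j)) ⟩
  ±ₚ (suc n) *ₚ det A
    ≈⟨ signₚ≈±ₚ*ₚ (suc n) (det A) ⟨
  signₚ (suc n) (det A) ∎
  where
  open ≈-Reasoning
  neg-inside : ∀ a s d → negₚ a *ₚ (s *ₚ d) ≈ negₚ s *ₚ (a *ₚ d)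
  neg-inside = solve-∀ polyAlmostCommRing

det-linear-row₀ : ∀ {n} r (A B M : PolyMat (suc n)) →
  (∀ s → M zero s ≈ A zero s +ₚ (r *ₚ B zero s)) →
  (∀ i s → M (suc i) s ≈ A (suc i) s) → (∀ i s → M (suc i) s ≈ B (suc i) s) →
  det M ≈ det A +ₚ (r *ₚ det B)
det-linear-row₀ r A B M row₀ rowsA rowsB = signedSum-linear r _ _ _ λ j → begin
  M zero j *ₚ det (minor M j)
    ≈⟨ *ₚ-congʳ (det (minor M j)) (row₀ j) ⟩
  (A zero j +ₚ (r *ₚ B zero j)) *ₚ det (minor M j)
    ≈⟨ distrib (A zero j) (B zero j) r (det (minor M j)) ⟩
  (A zero j *ₚ det (minor M j)) +ₚ (r *ₚ (B zero j *ₚ det (minor M j)))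
    ≈⟨ +ₚ-cong (*ₚ-congˡ (A zero j) (det-cong λ i k → rowsA i (punchIn j k)))
               (*ₚ-congˡ r (*ₚ-congˡ (B zero j) (det-cong λ i k → rowsB i (punchIn j k)))) ⟩
  (A zero j *ₚ det (minor A j)) +ₚ (r *ₚ (B zero j *ₚ det (minor B j))) ∎
  where
  open ≈-Reasoning
  distrib : ∀ a b r d → (a +ₚ (r *ₚ b)) *ₚ d ≈ (a *ₚ d) +ₚ (r *ₚ (b *ₚ d))
  distrib = solve-∀ polyAlmostCommRing

-- Along column 0 the terms of rows 0 and 1 cancel, and every other minor again has equal first rows.
det-rows₀₁-equal : ∀ {n} (A : PolyMat (suc (suc n))) → (∀ s → A zero s ≈ A (suc zero) s) → det A ≈ []
det-rows₀₁-equal {n} A e = begin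
  det A
    ≈⟨ det-expandColumn A ⟩
  t zero +ₚ (negₚ (t (suc zero)) +ₚ signedSum (λ i → t (suc (suc i))))
    ≈⟨ +ₚ-assoc (t zero) _ _ ⟨
  (t zero +ₚ negₚ (t (suc zero))) +ₚ signedSum (λ i → t (suc (suc i)))
    ≈⟨ +ₚ-cong (≈-trans (+ₚ-cong t₀≈t₁ ≈-refl) (negₚ-inverseʳ (t (suc zero)))) (remaining-terms n A e) ⟩
  [] ∎
  where
  open ≈-Reasoning
  t : Fin (suc (suc n)) → Poly
  t i = A i zero *ₚ det (minor (A ᵀ) i ᵀ)
  t₀≈t₁ : t zero ≈ t (suc zero)
  t₀≈t₁ = *-cong (e zero) (det-cong {A = minor (A ᵀ) zero ᵀ} {B = minor (A ᵀ) (suc zero) ᵀ} λ where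
    zero    s → ≈-sym (e (suc s))
    (suc r) s → ≈-refl)
  remaining-terms : ∀ n (A : PolyMat (suc (suc n))) → (∀ s → A zero s ≈ A (suc zero) s) →
    signedSum (λ i → A (suc (suc i)) zero *ₚ det (minor (A ᵀ) (suc (suc i)) ᵀ)) ≈ []
  remaining-terms zero    A e = ≈-refl
  remaining-terms (suc n) A e = signedSum-zero _ λ i → ≈-trans
    (*ₚ-congˡ (A (suc (suc i)) zero) (det-rows₀₁-equal (minor (A ᵀ) (suc (suc i)) ᵀ) (λ s → e (suc s))))
    (*ₚ-zeroʳ (A (suc (suc i)) zero))

det-addRow₀₁ : ∀ {n} c (A B : PolyMat (suc (suc n))) →
  (∀ s → B zero s ≈ A zero s) →
  (∀ s → B (suc zero) s ≈ A (suc zero) s +ₚ (c *ₚ A zero s)) →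
  (∀ i s → B (suc (suc i)) s ≈ A (suc (suc i)) s) →
  det B ≈ det A
det-addRow₀₁ {n} c A B row₀ row₁ rows = begin
  det B
    ≈⟨ signedSum-linear c _ _ _ term ⟩
  det A +ₚ (c *ₚ det A′)
    ≈⟨ +ₚ-cong ≈-refl (≈-trans (*ₚ-congˡ c (det-rows₀₁-equal A′ (λ _ → ≈-refl))) (*ₚ-zeroʳ c)) ⟩
  det A +ₚ []
    ≈⟨ +ₚ-identityʳ (det A) ⟩
  det A ∎
  where
  open ≈-Reasoning
  A′ : PolyMat (suc (suc n))
  A′ (suc zero) = A zero
  A′ i          = A i
  distrib : ∀ a c d e → a *ₚ (d +ₚ (c *ₚ e)) ≈ (a *ₚ d) +ₚ (c *ₚ (a *ₚ e))
  distrib = solve-∀ polyAlmostCommRing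
  term : ∀ j → B zero j *ₚ det (minor B j) ≈
               (A zero j *ₚ det (minor A j)) +ₚ (c *ₚ (A′ zero j *ₚ det (minor A′ j)))
  term j = ≈-trans
    (*-cong (row₀ j) (det-linear-row₀ c (minor A j) (minor A′ j) (minor B j)
      (λ s → row₁ (punchIn j s)) (λ i s → rows i (punchIn j s)) (λ i s → rows i (punchIn j s))))
    (distrib (A zero j) c (det (minor A j)) (det (minor A′ j)))

rowDifferences : ∀ {m n} → (Fin (suc m) → Fin n → Poly) → Fin (suc m) → Fin n → Poly
rowDifferences A zero    s = A zero s
rowDifferences A (suc i) s = A (suc i) s +ₚ negₚ (A (inject₁ i) s)

-- Restoring row 1 leaves A zero on top of the row differences of the remaining rows, and taking
-- differences of rows commutes with deleting a column, so induction applies to the minors along row 0.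
det-rowDifferences : ∀ {n} (A : PolyMat (suc n)) → det (rowDifferences A) ≈ det A
det-rowDifferences {zero}  A = ≈-refl
det-rowDifferences {suc n} A = ≈-trans
  (det-addRow₀₁ (negₚ (constₚ 1ℤ)) A₁ (rowDifferences A)
    (λ _ → ≈-refl) (λ s → subtract (A (suc zero) s) (A zero s)) (λ _ _ → ≈-refl))
  (signedSum-cong λ j → *ₚ-congˡ (A zero j) (≈-trans
    (det-cong {A = minor A₁ j} {B = rowDifferences (minor A j)} λ { zero k → ≈-refl ; (suc i) k → ≈-refl })
    (det-rowDifferences (minor A j))))
  where
  A₁ : PolyMat (suc (suc n))
  A₁ zero    = A zero
  A₁ (suc i) = rowDifferences (λ r → A (suc r)) i
  subtract : ∀ x y → x +ₚ negₚ y ≈ x +ₚ (negₚ (constₚ 1ℤ) *ₚ y)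
  subtract = solve-∀ polyAlmostCommRing

module _ {f : Poly → Poly} (isRingHom : IsPolyRingHomomorphism f) where
  open RingMorphisms.IsRingHomomorphism isRingHom

  signₚ-homo : ∀ k p → f (signₚ k p) ≈ signₚ k (f p)
  signₚ-homo zero          p = ≈-refl
  signₚ-homo (suc zero)    p = -‿homo p
  signₚ-homo (suc (suc k)) p = signₚ-homo k p

  sumFin-homo : ∀ {n} (g : Fin n → Poly) → f (sumFin g) ≈ sumFin (λ j → f (g j))
  sumFin-homo {zero}  g = 0#-homo
  sumFin-homo {suc n} g = ≈-trans (+-homo (g zero) _) (+ₚ-cong ≈-refl (sumFin-homo (λ j → g (suc j))))

  det-homo : ∀ {n} (A : PolyMat n) → f (det A) ≈ det (λ i j → f (A i j))
  det-homo {zero}  A = 1#-homo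
  det-homo {suc n} A = ≈-trans (sumFin-homo (λ j → signₚ (toℕ' j) (A zero j *ₚ det (minor A j))))
    (sumFin-cong λ j → ≈-trans (signₚ-homo (toℕ' j) _) (signₚ-cong (toℕ' j)
      (≈-trans (*-homo (A zero j) _) (*ₚ-congˡ (f (A zero j)) (det-homo (minor A j))))))

-- Composition of polynomials

infixl 30 _∘ₚ_
_∘ₚ_ : Poly → Poly → Poly
[]      ∘ₚ r = []
(a ∷ p) ∘ₚ r = constₚ a +ₚ (r *ₚ (p ∘ₚ r))

constₚ-zero : constₚ 0ℤ ≈ []
constₚ-zero = coeffwise λ { zero → refl ; (suc m) → refl }

≈[]⇒∘ₚ≈[] : ∀ {p} r → p ≈ [] → p ∘ₚ r ≈ []
≈[]⇒∘ₚ≈[] {[]}    r e = ≈-refl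
≈[]⇒∘ₚ≈[] {a ∷ p} r e = ≈-trans
  (+ₚ-cong (≈-trans (∷-cong (coeff-≈ e zero) ≈-refl) constₚ-zero)
           (*ₚ-congˡ r (≈[]⇒∘ₚ≈[] r (∷≈[]⇒≈[] e))))
  (*ₚ-zeroʳ r)

∘ₚ-cong : ∀ r {p q} → p ≈ q → p ∘ₚ r ≈ q ∘ₚ r
∘ₚ-cong r {[]}    {[]}    e = ≈-refl
∘ₚ-cong r {[]}    {b ∷ q} e = ≈-sym (≈[]⇒∘ₚ≈[] r (≈-sym e))
∘ₚ-cong r {a ∷ p} {[]}    e = ≈[]⇒∘ₚ≈[] r e
∘ₚ-cong r {a ∷ p} {b ∷ q} e =
  +ₚ-cong (∷-cong (coeff-≈ e zero) ≈-refl) (*ₚ-congˡ r (∘ₚ-cong r (∷-injectiveʳ e)))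

∘ₚ-+ₚ : ∀ r p q → (p +ₚ q) ∘ₚ r ≈ (p ∘ₚ r) +ₚ (q ∘ₚ r)
∘ₚ-+ₚ r []      q       = ≈-refl
∘ₚ-+ₚ r (a ∷ p) []      = ≈-sym (+ₚ-identityʳ _)
∘ₚ-+ₚ r (a ∷ p) (b ∷ q) = ≈-trans
  (+ₚ-cong (∷-cong refl ≈-refl) (*ₚ-congˡ r (∘ₚ-+ₚ r p q)))
  (rearrange (constₚ a) (constₚ b) r (p ∘ₚ r) (q ∘ₚ r))
  where
  rearrange : ∀ a b r x y → (a +ₚ b) +ₚ (r *ₚ (x +ₚ y)) ≈ (a +ₚ (r *ₚ x)) +ₚ (b +ₚ (r *ₚ y))
  rearrange = solve-∀ polyAlmostCommRing

∘ₚ-negₚ : ∀ r p → negₚ p ∘ₚ r ≈ negₚ (p ∘ₚ r)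
∘ₚ-negₚ r []      = ≈-refl
∘ₚ-negₚ r (a ∷ p) = ≈-trans
  (+ₚ-cong (≈-refl {negₚ (constₚ a)}) (*ₚ-congˡ r (∘ₚ-negₚ r p)))
  (rearrange (constₚ a) r (p ∘ₚ r))
  where
  rearrange : ∀ a r x → negₚ a +ₚ (r *ₚ negₚ x) ≈ negₚ (a +ₚ (r *ₚ x))
  rearrange = solve-∀ polyAlmostCommRing

∘ₚ-constₚ : ∀ r a → constₚ a ∘ₚ r ≈ constₚ a
∘ₚ-constₚ r a = ≈-trans (+ₚ-cong (≈-refl {constₚ a}) (*ₚ-zeroʳ r)) (+ₚ-identityʳ _)

∘ₚ-· : ∀ r a q → (a · q) ∘ₚ r ≈ constₚ a *ₚ (q ∘ₚ r)
∘ₚ-· r a []      = ≈-sym (*ₚ-zeroʳ (constₚ a))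
∘ₚ-· r a (b ∷ q) = ≈-trans
  (+ₚ-cong (∷-cong (sym (ℤP.+-identityʳ _)) ≈-refl) (*ₚ-congˡ r (∘ₚ-· r a q)))
  (rearrange (constₚ a) (constₚ b) r (q ∘ₚ r))
  where
  rearrange : ∀ a b r x → (a *ₚ b) +ₚ (r *ₚ (a *ₚ x)) ≈ a *ₚ (b +ₚ (r *ₚ x))
  rearrange = solve-∀ polyAlmostCommRing

∘ₚ-*ₚ : ∀ r p q → (p *ₚ q) ∘ₚ r ≈ (p ∘ₚ r) *ₚ (q ∘ₚ r)
∘ₚ-*ₚ r []      q = ≈-refl
∘ₚ-*ₚ r (a ∷ p) q = begin
  ((a · q) +ₚ (0ℤ ∷ p *ₚ q)) ∘ₚ r
    ≈⟨ ∘ₚ-+ₚ r (a · q) (0ℤ ∷ p *ₚ q) ⟩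
  ((a · q) ∘ₚ r) +ₚ (constₚ 0ℤ +ₚ (r *ₚ ((p *ₚ q) ∘ₚ r)))
    ≈⟨ +ₚ-cong (∘ₚ-· r a q) (+ₚ-cong constₚ-zero (*ₚ-congˡ r (∘ₚ-*ₚ r p q))) ⟩
  (constₚ a *ₚ (q ∘ₚ r)) +ₚ (r *ₚ ((p ∘ₚ r) *ₚ (q ∘ₚ r)))
    ≈⟨ rearrange (constₚ a) r (p ∘ₚ r) (q ∘ₚ r) ⟩
  (constₚ a +ₚ (r *ₚ (p ∘ₚ r))) *ₚ (q ∘ₚ r) ∎
  where
  open ≈-Reasoning
  rearrange : ∀ a r x y → (a *ₚ y) +ₚ (r *ₚ (x *ₚ y)) ≈ (a +ₚ (r *ₚ x)) *ₚ y
  rearrange = solve-∀ polyAlmostCommRing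

∘ₚ-isRingHomomorphism : ∀ r → IsPolyRingHomomorphism (_∘ₚ r)
∘ₚ-isRingHomomorphism r = record
  { isSemiringHomomorphism = record
    { isNearSemiringHomomorphism = record
      { +-isMonoidHomomorphism = record
        { isMagmaHomomorphism = record
          { isRelHomomorphism = record { cong = ∘ₚ-cong r }
          ; homo = ∘ₚ-+ₚ r }
        ; ε-homo = ≈-refl }
      ; *-homo = ∘ₚ-*ₚ r }
    ; 1#-homo = ∘ₚ-constₚ r 1ℤ }
  ; -‿homo = ∘ₚ-negₚ r }

∘ₚ-X : ∀ r → Xₚ ∘ₚ r ≈ r
∘ₚ-X r = ≈-trans (+ₚ-cong constₚ-zero (*ₚ-congˡ r (∘ₚ-constₚ r 1ℤ))) (*ₚ-identityʳ r)

DegreeAtMost : ℕ → Poly → Set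
DegreeAtMost d p = ∀ m → d < m → coeff p m ≡ 0ℤ

DegreeAtMost-cong : ∀ {d p q} → p ≈ q → DegreeAtMost d p → DegreeAtMost d q
DegreeAtMost-cong e deg m d<m = trans (sym (coeff-≈ e m)) (deg m d<m)

*ₚ-leading : ∀ d e p q → DegreeAtMost d p → DegreeAtMost e q →
  DegreeAtMost (d +ℕ e) (p *ₚ q) × coeff (p *ₚ q) (d +ℕ e) ≡ coeff p d * coeff q e
*ₚ-leading d e [] q degp degq = (λ m _ → refl) , sym (ℤP.*-zeroˡ (coeff q e))
*ₚ-leading zero e (a ∷ p) q degp degq =
  DegreeAtMost-cong (≈-sym a∷p*q≈a·q) bound , trans (coeff-≈ a∷p*q≈a·q e) (coeff-· a q e)
  where
  a∷p*q≈a·q : (a ∷ p) *ₚ q ≈ a · q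
  a∷p*q≈a·q = ≈-trans
    (+ₚ-cong (≈-refl {a · q}) (∷-cong refl (≈[]⇒*ₚ≈[] {p} q (coeffwise λ m → degp (suc m) (s≤s z≤n)))))
                      (≈-trans (+ₚ-cong (≈-refl {a · q}) constₚ-zero) (+ₚ-identityʳ (a · q)))
  bound : DegreeAtMost e (a · q)
  bound m e<m = trans (coeff-· a q m) (trans (cong (a *_) (degq m e<m)) (ℤP.*-zeroʳ a))
*ₚ-leading (suc d) e (a ∷ p) q degp degq = bound , top
  where
  ih = *ₚ-leading d e p q (λ m d<m → degp (suc m) (s≤s d<m)) degq
  a·q-vanishes : ∀ m → e < m → a * coeff q m ≡ 0ℤ
  a·q-vanishes m e<m = trans (cong (a *_) (degq m e<m)) (ℤP.*-zeroʳ a)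
  bound : DegreeAtMost (suc d +ℕ e) ((a ∷ p) *ₚ q)
  bound (suc m) (s≤s d+e<m) = trans (coeff-*ₚ-suc a p q m)
    (cong₂ _+_ (a·q-vanishes (suc m) (s≤s (ℕP.≤-trans (ℕP.m≤n+m e d) (ℕP.<⇒≤ d+e<m)))) (proj₁ ih m d+e<m))
  top : coeff ((a ∷ p) *ₚ q) (suc (d +ℕ e)) ≡ coeff p d * coeff q e
  top = trans (coeff-*ₚ-suc a p q (d +ℕ e))
    (trans (cong₂ _+_ (a·q-vanishes (suc (d +ℕ e)) (s≤s (ℕP.m≤n+m e d))) (proj₂ ih)) (ℤP.+-identityˡ _))

TopCoeff : ℕ → Poly → Poly → Set
TopCoeff d p q = DegreeAtMost d p × coeff p d ≡ coeff q 0

TopCoeff-+ₚ : ∀ {d} p q p′ q′ → TopCoeff d p p′ → TopCoeff d q q′ → TopCoeff d (p +ₚ q) (p′ +ₚ q′)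
TopCoeff-+ₚ {d} p q p′ q′ (degp , topp) (degq , topq) =
  (λ m d<m → trans (coeff-+ₚ p q m) (cong₂ _+_ (degp m d<m) (degq m d<m))) ,
  trans (coeff-+ₚ p q d) (trans (cong₂ _+_ topp topq) (sym (coeff-+ₚ p′ q′ 0)))

TopCoeff-signₚ : ∀ {d} k p p′ → TopCoeff d p p′ → TopCoeff d (signₚ k p) (signₚ k p′)
TopCoeff-signₚ {d} k p p′ (degp , topp) =
  (λ m d<m → trans (coeff-signₚ k p m) (trans (cong (s *_) (degp m d<m)) (ℤP.*-zeroʳ s))) ,
  trans (coeff-signₚ k p d) (trans (cong (s *_) topp) (sym (coeff-signₚ k p′ 0)))
  where s = (- 1ℤ) ^ℤ k

TopCoeff-sumFin : ∀ {d n} (f g : Fin n → Poly) → (∀ j → TopCoeff d (f j) (g j)) → TopCoeff d (sumFin f) (sumFin g)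
TopCoeff-sumFin {d} {zero}  f g t = (λ m _ → refl) , refl
TopCoeff-sumFin {d} {suc n} f g t = TopCoeff-+ₚ (f zero) _ (g zero) _ (t zero)
  (TopCoeff-sumFin (λ j → f (suc j)) (λ j → g (suc j)) (λ j → t (suc j)))

TopCoeff-*ₚ : ∀ {n} a p p′ → DegreeAtMost 1 a → TopCoeff n p p′ →
  TopCoeff (suc n) (a *ₚ p) (constₚ (coeff a 1) *ₚ p′)
TopCoeff-*ₚ {n} a p p′ dega (degp , topp) =
  proj₁ leading , trans (proj₂ leading) (trans (cong (coeff a 1 *_) topp) (sym (coeff-*ₚ-zero (coeff a 1) [] p′)))
  where leading = *ₚ-leading 1 n a p dega degp

det-TopCoeff : ∀ {n} (A : PolyMat n) → (∀ i j → DegreeAtMost 1 (A i j)) →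
  TopCoeff n (det A) (det (λ i j → constₚ (coeff (A i j) 1)))
det-TopCoeff {zero}  A bound = (λ { (suc m) _ → refl }) , refl
det-TopCoeff {suc n} A bound = TopCoeff-sumFin
  (λ j → signₚ (toℕ' j) (A zero j *ₚ det (minor A j)))
  (λ j → signₚ (toℕ' j) (lead zero j *ₚ det (minor lead j)))
  λ j → TopCoeff-signₚ (toℕ' j) _ _
    (TopCoeff-*ₚ (A zero j) (det (minor A j)) (det (minor lead j)) (bound zero j)
                 (det-TopCoeff (minor A j) (λ i k → bound (suc i) (punchIn j k))))
  where
  lead : PolyMat (suc n)
  lead i j = constₚ (coeff (A i j) 1)

strip-≈[] : ∀ p → p ≈ [] → strip p ≡ []
strip-≈[] []      e = refl
strip-≈[] (a ∷ p) e with strip p | strip-≈[] p (∷≈[]⇒≈[] e)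
... | [] | refl with coeff-≈ e zero
...   | refl = refl

isZero-≢0 : ∀ {a} → a ≢ 0ℤ → isZero a ≡ false
isZero-≢0 {a} a≢0 with a ℤ≟ 0ℤ
... | yes a≡0 = ⊥-elim (a≢0 a≡0)
... | no  _   = refl

length-strip : ∀ d p → DegreeAtMost d p → coeff p d ≢ 0ℤ → length (strip p) ≡ suc d
length-strip d       []      bound top≢0 = ⊥-elim (top≢0 refl)
length-strip zero    (a ∷ p) bound top≢0
  with strip p | strip-≈[] p (coeffwise λ m → bound (suc m) (s≤s z≤n))
... | [] | refl rewrite isZero-≢0 top≢0 = refl
length-strip (suc d) (a ∷ p) bound top≢0
  with strip p | length-strip d p (λ m d<m → bound (suc m) (s≤s d<m)) top≢0
... | _ ∷ _ | length≡ = cong suc length≡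

deg-exact : ∀ d p → DegreeAtMost d p → coeff p d ≢ 0ℤ → deg p ≡ d
deg-exact d p bound top≢0 = cong (_∸ 1) (length-strip d p bound top≢0)

δ-diag : ∀ {n} (i : Fin n) → δ i i ≡ 1ℤ
δ-diag i with i ≟ᶠ i
... | yes _   = refl
... | no  i≢i = ⊥-elim (i≢i refl)

δ-offDiag : ∀ {n} {i j : Fin n} → i ≢ j → δ i j ≡ 0ℤ
δ-offDiag {i = i} {j} i≢j with i ≟ᶠ j
... | yes i≡j = ⊥-elim (i≢j i≡j)
... | no  _   = refl

δ-suc : ∀ {n} (i j : Fin n) → δ (suc i) (suc j) ≡ δ i j
δ-suc i j = cases (i ≟ᶠ j)
  where
  cases : Dec (i ≡ j) → δ (suc i) (suc j) ≡ δ i j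
  cases (yes refl) = trans (δ-diag (suc i)) (sym (δ-diag i))
  cases (no  i≢j)  = trans (δ-offDiag (i≢j ∘ suc-injective)) (sym (δ-offDiag i≢j))

δ-sym : ∀ {n} (i j : Fin n) → δ i j ≡ δ j i
δ-sym i j = cases (i ≟ᶠ j)
  where
  cases : Dec (i ≡ j) → δ i j ≡ δ j i
  cases (yes refl) = refl
  cases (no  i≢j)  = trans (δ-offDiag i≢j) (sym (δ-offDiag (i≢j ∘ sym)))

det-identity : ∀ {n} → det {n} (λ i j → constₚ (δ i j)) ≈ constₚ 1ℤ
det-identity {zero}  = ≈-refl
det-identity {suc n} = begin
  (I zero zero *ₚ det (minor I zero)) +ₚ sumFin (λ j → signₚ (suc (toℕ' j)) (offDiagonal j))
    ≈⟨ +ₚ-cong diagonal (≈-trans (signedSum-shift offDiagonal) (negₚ-cong (signedSum-zero offDiagonal vanishes))) ⟩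
  constₚ 1ℤ +ₚ []
    ≈⟨ +ₚ-identityʳ (constₚ 1ℤ) ⟩
  constₚ 1ℤ ∎
  where
  open ≈-Reasoning
  I : PolyMat (suc n)
  I i j = constₚ (δ i j)
  diagonal : I zero zero *ₚ det (minor I zero) ≈ constₚ 1ℤ
  diagonal = ≈-trans (*-cong (∷-cong {p = []} (δ-diag {suc n} zero) ≈-refl)
                             (≈-trans (det-cong {n} λ i k → ∷-cong {p = []} (δ-suc i k) ≈-refl) (det-identity {n})))
                     (*ₚ-identityˡ (constₚ 1ℤ))
  offDiagonal : Fin n → Poly
  offDiagonal j = I zero (suc j) *ₚ det (minor I (suc j))
  vanishes : ∀ j → offDiagonal j ≈ []
  vanishes j = ≈[]⇒*ₚ≈[] (det (minor I (suc j)))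
    (≈-trans (∷-cong {p = []} (δ-offDiag {i = zero} {j = suc j} (λ ())) ≈-refl) constₚ-zero)

±1-Entries : ∀ {n} → Mat n → Set
±1-Entries M = ∀ i j → M i j ≡ 1ℤ ⊎ M i j ≡ - 1ℤ

SkewSymmetric : ∀ {n} → Mat n → Set
SkewSymmetric S = ∀ i j → S j i ≡ - S i j

charMatrix : ∀ {n} → Mat n → PolyMat n
charMatrix M i j = (constₚ (δ i j) *ₚ Xₚ) +ₚ negₚ (constₚ (M i j))

charMatrix-degree : ∀ {n} (M : Mat n) i j → DegreeAtMost 1 (charMatrix M i j)
charMatrix-degree M i j (suc zero)    (s≤s ())
charMatrix-degree M i j (suc (suc m)) _ = refl

charPoly-monic : ∀ {n} (M : Mat n) → TopCoeff n (Char M) (constₚ 1ℤ)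
charPoly-monic {n} M with det-TopCoeff (charMatrix M) (charMatrix-degree M)
... | bound , top = bound , trans top (coeff-≈ (≈-trans
  (det-cong {n} {B = λ i j → constₚ (δ i j)} λ i j → ∷-cong {p = []} (ℤP.*-identityʳ (δ i j)) ≈-refl)
  (det-identity {n})) 0)

charPoly-degree : ∀ {n} (M : Mat n) → deg (Char M) ≡ n
charPoly-degree {n} M = deg-exact n (Char M) (proj₁ (charPoly-monic M)) λ top≡0 →
  1≢0 (trans (sym (proj₂ (charPoly-monic M))) top≡0)
  where
  1≢0 : 1ℤ ≢ 0ℤ
  1≢0 ()

c-charPoly : ∀ {n} (M : Mat n) k → c k (Char M) ≡ coeff (Char M) (n ∸ k)
c-charPoly M k = cong (λ d → coeff (Char M) (d ∸ k)) (charPoly-degree M)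

-- Powers of the ideal (2, X)

two^ : ℕ → ℤ
two^ e = + (2 ^ e)

two^-+ : ∀ a b → two^ (a +ℕ b) ≡ two^ a * two^ b
two^-+ a b = trans (cong +_ (ℕP.^-distribˡ-+-* 2 a b)) (ℤP.pos-* (2 ^ a) (2 ^ b))

two^-mono-∣ : ∀ {a b} → a ≤ b → two^ a DS.∣ two^ b
two^-mono-∣ {a} {b} a≤b =
  DS.divides (two^ (b ∸ a)) (trans (cong two^ (sym (ℕP.m∸n+n≡m a≤b))) (two^-+ (b ∸ a) a))

-- As a ℤ-module, (2, X)^e is spanned by the monomials 2^(e ∸ m) X^m.
infix 4 _∈⟨2,X⟩^_
_∈⟨2,X⟩^_ : Poly → ℕ → Set
p ∈⟨2,X⟩^ e = ∀ m → two^ (e ∸ m) DS.∣ coeff p m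

∈⟨2,X⟩^-resp-≈ : ∀ {e p q} → p ≈ q → p ∈⟨2,X⟩^ e → q ∈⟨2,X⟩^ e
∈⟨2,X⟩^-resp-≈ {e} p≈q p∈ m = subst (two^ (e ∸ m) DS.∣_) (coeff-≈ p≈q m) (p∈ m)

two^[0∸m]∣ : ∀ m x → two^ (0 ∸ m) DS.∣ x
two^[0∸m]∣ m x rewrite ℕP.0∸n≡0 m = DS.divides x (sym (ℤP.*-identityʳ x))

∈⟨2,X⟩^0 : ∀ p → p ∈⟨2,X⟩^ 0
∈⟨2,X⟩^0 p m = two^[0∸m]∣ m (coeff p m)

[]-∈⟨2,X⟩^ : ∀ {e} → [] ∈⟨2,X⟩^ e
[]-∈⟨2,X⟩^ m = DS.divides 0ℤ refl

+ₚ-∈⟨2,X⟩^ : ∀ {e} p q → p ∈⟨2,X⟩^ e → q ∈⟨2,X⟩^ e → (p +ₚ q) ∈⟨2,X⟩^ e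
+ₚ-∈⟨2,X⟩^ {e} p q p∈ q∈ m =
  subst (two^ (e ∸ m) DS.∣_) (sym (coeff-+ₚ p q m)) (DS.∣m∣n⇒∣m+n (p∈ m) (q∈ m))

signₚ-∈⟨2,X⟩^ : ∀ {e} k p → p ∈⟨2,X⟩^ e → signₚ k p ∈⟨2,X⟩^ e
signₚ-∈⟨2,X⟩^ {e} k p p∈ m =
  subst (two^ (e ∸ m) DS.∣_) (sym (coeff-signₚ k p m)) (DS.∣n⇒∣m*n ((- 1ℤ) ^ℤ k) (p∈ m))

sumFin-∈⟨2,X⟩^ : ∀ {e n} (f : Fin n → Poly) → (∀ j → f j ∈⟨2,X⟩^ e) → sumFin f ∈⟨2,X⟩^ e
sumFin-∈⟨2,X⟩^ {n = zero}  f f∈ = []-∈⟨2,X⟩^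
sumFin-∈⟨2,X⟩^ {n = suc n} f f∈ =
  +ₚ-∈⟨2,X⟩^ (f zero) _ (f∈ zero) (sumFin-∈⟨2,X⟩^ (λ j → f (suc j)) (λ j → f∈ (suc j)))

∷-∈⟨2,X⟩^ : ∀ {e a p} → (a ∷ p) ∈⟨2,X⟩^ e → p ∈⟨2,X⟩^ (e ∸ 1)
∷-∈⟨2,X⟩^ {e} {a} {p} a∷p∈ m = subst (λ d → two^ d DS.∣ coeff p m) (sym (ℕP.∸-+-assoc e 1 m)) (a∷p∈ (suc m))

m+n∸o≤m+[n∸o] : ∀ m n o → m +ℕ n ∸ o ≤ m +ℕ (n ∸ o)
m+n∸o≤m+[n∸o] m n       zero    = ℕP.≤-refl
m+n∸o≤m+[n∸o] m zero    (suc o) = ℕP.m∸n≤m (m +ℕ 0) (suc o)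
m+n∸o≤m+[n∸o] m (suc n) (suc o) =
  subst (λ k → k ∸ suc o ≤ m +ℕ (n ∸ o)) (sym (ℕP.+-suc m n)) (m+n∸o≤m+[n∸o] m n o)

m+n∸1≤[m∸1]+n : ∀ m n → m +ℕ n ∸ 1 ≤ (m ∸ 1) +ℕ n
m+n∸1≤[m∸1]+n zero    n = ℕP.m∸n≤m n 1
m+n∸1≤[m∸1]+n (suc m) n = ℕP.≤-refl

*-∣-* : ∀ {a b x y} → a DS.∣ x → b DS.∣ y → (a * b) DS.∣ (x * y)
*-∣-* {a} {b} {x} {y} a∣x b∣y = DS.∣-trans (DS.*-monoˡ-∣ b a∣x) (DS.*-monoʳ-∣ x b∣y)

*ₚ-∈⟨2,X⟩^ : ∀ e f p q → p ∈⟨2,X⟩^ e → q ∈⟨2,X⟩^ f → (p *ₚ q) ∈⟨2,X⟩^ (e +ℕ f)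
*ₚ-∈⟨2,X⟩^ e f []      q p∈ q∈ = []-∈⟨2,X⟩^
*ₚ-∈⟨2,X⟩^ e f (a ∷ p) q p∈ q∈ = +ₚ-∈⟨2,X⟩^ (a · q) (0ℤ ∷ (p *ₚ q)) head-part tail-part
  where
  head-part : (a · q) ∈⟨2,X⟩^ (e +ℕ f)
  head-part m = subst (two^ (e +ℕ f ∸ m) DS.∣_) (sym (coeff-· a q m)) (DS.∣-trans
    (subst (two^ (e +ℕ f ∸ m) DS.∣_) (two^-+ e (f ∸ m)) (two^-mono-∣ (m+n∸o≤m+[n∸o] e f m)))
    (*-∣-* (p∈ zero) (q∈ m)))
  tail-part : (0ℤ ∷ (p *ₚ q)) ∈⟨2,X⟩^ (e +ℕ f)
  tail-part zero    = DS.divides 0ℤ refl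
  tail-part (suc m) = DS.∣-trans
    (two^-mono-∣ (subst (_≤ (e ∸ 1) +ℕ f ∸ m) (ℕP.∸-+-assoc (e +ℕ f) 1 m)
                        (ℕP.∸-monoˡ-≤ m (m+n∸1≤[m∸1]+n e f))))
    (*ₚ-∈⟨2,X⟩^ (e ∸ 1) f p q (∷-∈⟨2,X⟩^ p∈) q∈ m)

laplace-∈⟨2,X⟩^ : ∀ {n} e f (A : PolyMat (suc n)) →
  (∀ j → A zero j ∈⟨2,X⟩^ e) → (∀ j → det (minor A j) ∈⟨2,X⟩^ f) → det A ∈⟨2,X⟩^ (e +ℕ f)
laplace-∈⟨2,X⟩^ e f A row₀∈ minors∈ =
  sumFin-∈⟨2,X⟩^ (λ j → signₚ (toℕ' j) (A zero j *ₚ det (minor A j))) λ j →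
  signₚ-∈⟨2,X⟩^ (toℕ' j) _ (*ₚ-∈⟨2,X⟩^ e f (A zero j) (det (minor A j)) (row₀∈ j) (minors∈ j))

det-∈⟨2,X⟩^ : ∀ {n} (A : PolyMat n) → (∀ i j → A i j ∈⟨2,X⟩^ 1) → det A ∈⟨2,X⟩^ n
det-∈⟨2,X⟩^ {zero}  A A∈ = ∈⟨2,X⟩^0 (constₚ 1ℤ)
det-∈⟨2,X⟩^ {suc n} A A∈ = laplace-∈⟨2,X⟩^ 1 n A (A∈ zero) λ j →
  det-∈⟨2,X⟩^ (minor A j) (λ i k → A∈ (suc i) (punchIn j k))

coeff₀-charMatrix : ∀ {n} (M : Mat n) i j → coeff (charMatrix M i j) 0 ≡ - M i j
coeff₀-charMatrix M i j =
  trans (cong (_+ - M i j) (trans (ℤP.+-identityʳ _) (ℤP.*-zeroʳ (δ i j)))) (ℤP.+-identityˡ _)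

±1-difference-even : ∀ {x y} → x ≡ 1ℤ ⊎ x ≡ - 1ℤ → y ≡ 1ℤ ⊎ y ≡ - 1ℤ → two^ 1 DS.∣ - x + - (- y)
±1-difference-even (inj₁ refl) (inj₁ refl) = DS.divides 0ℤ refl
±1-difference-even (inj₁ refl) (inj₂ refl) = DS.divides (- 1ℤ) refl
±1-difference-even (inj₂ refl) (inj₁ refl) = DS.divides 1ℤ refl
±1-difference-even (inj₂ refl) (inj₂ refl) = DS.divides 0ℤ refl

charPoly-∈⟨2,X⟩^ : ∀ {n} (M : Mat (suc n)) → ±1-Entries M → Char M ∈⟨2,X⟩^ n
charPoly-∈⟨2,X⟩^ {n} M ±1 = ∈⟨2,X⟩^-resp-≈ (det-rowDifferences (charMatrix M))
  (laplace-∈⟨2,X⟩^ 0 n (rowDifferences (charMatrix M)) (λ j → ∈⟨2,X⟩^0 (charMatrix M zero j)) λ j →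
    det-∈⟨2,X⟩^ (minor (rowDifferences (charMatrix M)) j) λ i k → difference∈ i (punchIn j k))
  where
  difference∈ : ∀ i s → rowDifferences (charMatrix M) (suc i) s ∈⟨2,X⟩^ 1
  difference∈ i s zero = subst (two^ 1 DS.∣_)
    (sym (trans (coeff-+ₚ (charMatrix M (suc i) s) (negₚ (charMatrix M (inject₁ i) s)) 0)
                (cong₂ _+_ (coeff₀-charMatrix M (suc i) s)
                           (trans (coeff-negₚ (charMatrix M (inject₁ i) s) 0)
                                  (cong -_ (coeff₀-charMatrix M (inject₁ i) s))))))
    (±1-difference-even (±1 (suc i) s) (±1 (inject₁ i) s))
  difference∈ i s (suc m) = two^[0∸m]∣ m (coeff (rowDifferences (charMatrix M) (suc i) s) (suc m))

Σ<-cong : ∀ L {f g : ℕ → ℤ} → (∀ i → i < L → f i ≡ g i) → Σ< L f ≡ Σ< L g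
Σ<-cong zero    f≡g = refl
Σ<-cong (suc L) f≡g = cong₂ _+_ (Σ<-cong L (λ i i<L → f≡g i (ℕP.m<n⇒m<1+n i<L))) (f≡g L (ℕP.n<1+n L))

Σ<-+ : ∀ L (f g : ℕ → ℤ) → Σ< L (λ i → f i + g i) ≡ Σ< L f + Σ< L g
Σ<-+ zero    f g = refl
Σ<-+ (suc L) f g = trans (cong (_+ (f L + g L)) (Σ<-+ L f g)) (interchange (Σ< L f) (Σ< L g) (f L) (g L))
  where
  interchange : ∀ a b c d → (a + b) + (c + d) ≡ (a + c) + (b + d)
  interchange = ℤ-solve

Σ<-head : ∀ L (f : ℕ → ℤ) → Σ< (suc L) f ≡ f 0 + Σ< L (λ i → f (suc i))
Σ<-head zero    f = trans (ℤP.+-identityˡ (f 0)) (sym (ℤP.+-identityʳ (f 0)))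
Σ<-head (suc L) f = trans (cong (_+ f (suc L)) (Σ<-head L f)) (ℤP.+-assoc (f 0) _ _)

Σ<-reverse : ∀ L (f : ℕ → ℤ) → Σ< L f ≡ Σ< L (λ i → f (L ∸ suc i))
Σ<-reverse zero    f = refl
Σ<-reverse (suc L) f = begin
  Σ< L f + f L                         ≡⟨ ℤP.+-comm (Σ< L f) (f L) ⟩
  f L + Σ< L f                         ≡⟨ cong (_+_ (f L)) (Σ<-reverse L f) ⟩
  f L + Σ< L (λ i → f (L ∸ suc i))     ≡⟨ Σ<-head L (λ i → f (suc L ∸ suc i)) ⟨
  Σ< (suc L) (λ i → f (suc L ∸ suc i)) ∎
  where open ≡-Reasoning

Σ<-vanishing : ∀ {K L} (f : ℕ → ℤ) → K ≤ L → (∀ i → K ≤ i → i < L → f i ≡ 0ℤ) → Σ< L f ≡ Σ< K f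
Σ<-vanishing {L = zero}  f z≤n       f≡0 = refl
Σ<-vanishing {L = suc L} f K≤1+L f≡0 with ℕP.m≤n⇒m<n∨m≡n K≤1+L
... | inj₂ refl      = refl
... | inj₁ (s≤s K≤L) = trans
  (cong₂ _+_ (Σ<-vanishing f K≤L (λ i K≤i i<L → f≡0 i K≤i (ℕP.m<n⇒m<1+n i<L))) (f≡0 L K≤L (ℕP.n<1+n L)))
  (ℤP.+-identityʳ _)

Xₚ-*ₚ : ∀ q → Xₚ *ₚ q ≈ (0ℤ ∷ q)
Xₚ-*ₚ q = ≈-trans (0∷-*ₚ (constₚ 1ℤ) q) (∷-cong refl (*ₚ-identityˡ q))

X+1 : Poly
X+1 = Xₚ +ₚ constₚ 1ℤ

coeff-∘ₚX+1 : ∀ p m → coeff (p ∘ₚ X+1) m ≡ Σ< (length p) (λ j → + (j C m) * coeff p j)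
coeff-∘ₚX+1 []      m = refl
coeff-∘ₚX+1 (a ∷ p) m = begin
  coeff ((a ∷ p) ∘ₚ X+1) m
    ≡⟨ coeff-≈ (+ₚ-cong (≈-refl {constₚ a}) (≈-trans (*ₚ-distribʳ-+ₚ q Xₚ (constₚ 1ℤ))
                                                   (+ₚ-cong (Xₚ-*ₚ q) (*ₚ-identityˡ q)))) m ⟩
  coeff (constₚ a +ₚ ((0ℤ ∷ q) +ₚ q)) m
    ≡⟨ trans (coeff-+ₚ (constₚ a) ((0ℤ ∷ q) +ₚ q) m)
             (cong (_+_ (coeff (constₚ a) m)) (coeff-+ₚ (0ℤ ∷ q) q m)) ⟩
  coeff (constₚ a) m + (coeff (0ℤ ∷ q) m + coeff q m)
    ≡⟨ lowest-and-rest m ⟩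
  + (0 C m) * a + Σ< (length p) (λ j → + (suc j C m) * coeff p j)
    ≡⟨ Σ<-head (length p) (λ j → + (j C m) * coeff (a ∷ p) j) ⟨
  Σ< (length (a ∷ p)) (λ j → + (j C m) * coeff (a ∷ p) j) ∎
  where
  open ≡-Reasoning
  q = p ∘ₚ X+1
  lowest-and-rest : ∀ m → coeff (constₚ a) m + (coeff (0ℤ ∷ q) m + coeff q m) ≡
                          + (0 C m) * a + Σ< (length p) (λ j → + (suc j C m) * coeff p j)
  lowest-and-rest zero    = cong₂ _+_ (sym (ℤP.*-identityˡ a)) (trans (ℤP.+-identityˡ _) (coeff-∘ₚX+1 p 0))
  lowest-and-rest (suc m) = begin
    0ℤ + (coeff q m + coeff q (suc m))
      ≡⟨ ℤP.+-identityˡ _ ⟩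
    coeff q m + coeff q (suc m)
      ≡⟨ cong₂ _+_ (coeff-∘ₚX+1 p m) (coeff-∘ₚX+1 p (suc m)) ⟩
    Σ< (length p) (λ j → + (j C m) * coeff p j) + Σ< (length p) (λ j → + (j C suc m) * coeff p j)
      ≡⟨ Σ<-+ (length p) _ _ ⟨
    Σ< (length p) (λ j → + (j C m) * coeff p j + + (j C suc m) * coeff p j)
      ≡⟨ Σ<-cong (length p) (λ j _ → pascal j) ⟩
    Σ< (length p) (λ j → + (suc j C suc m) * coeff p j)
      ≡⟨ ℤP.+-identityˡ _ ⟨
    0ℤ + Σ< (length p) (λ j → + (suc j C suc m) * coeff p j) ∎
    where
    pascal : ∀ j → + (j C m) * coeff p j + + (j C suc m) * coeff p j ≡ + (suc j C suc m) * coeff p j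
    pascal j = trans (sym (ℤP.*-distribʳ-+ (coeff p j) (+ (j C m)) (+ (j C suc m))))
      (cong (_* coeff p j) (trans (sym (ℤP.pos-+ (j C m) (j C suc m))) (cong +_ (nCk+nC[k+1]≡[n+1]C[k+1] j m))))

coeff-∘ₚ-X : ∀ p m → coeff (p ∘ₚ negₚ Xₚ) m ≡ (- 1ℤ) ^ℤ m * coeff p m
coeff-∘ₚ-X []      m       = sym (ℤP.*-zeroʳ ((- 1ℤ) ^ℤ m))
coeff-∘ₚ-X (a ∷ p) m       = trans (coeff-≈ a∷p∘-X m) (lemma m)
  where
  q = p ∘ₚ negₚ Xₚ
  a∷p∘-X : (a ∷ p) ∘ₚ negₚ Xₚ ≈ (a ∷ negₚ q)
  a∷p∘-X = ≈-trans (+ₚ-cong (≈-refl {constₚ a}) (≈-trans (neg-out Xₚ q) (negₚ-cong (Xₚ-*ₚ q))))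
                   (∷-cong (ℤP.+-identityʳ a) ≈-refl)
    where
    neg-out : ∀ x s → negₚ x *ₚ s ≈ negₚ (x *ₚ s)
    neg-out = solve-∀ polyAlmostCommRing
  lemma : ∀ m → coeff (a ∷ negₚ q) m ≡ (- 1ℤ) ^ℤ m * coeff (a ∷ p) m
  lemma zero    = sym (ℤP.*-identityˡ a)
  lemma (suc m) = trans (coeff-negₚ q m) (trans (cong -_ (coeff-∘ₚ-X p m))
    (trans (ℤP.neg-distribˡ-* ((- 1ℤ) ^ℤ m) (coeff p m)) (cong (_* coeff p m) (sym (ℤP.-1*i≡-i ((- 1ℤ) ^ℤ m))))))

coeff-length : ∀ p {j} → length p ≤ j → coeff p j ≡ 0ℤ
coeff-length []      _         = refl
coeff-length (a ∷ p) (s≤s len≤j) = coeff-length p len≤j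

Σ<-length-degree : ∀ n p (g : ℕ → ℤ) → DegreeAtMost n p →
  Σ< (length p) (λ j → g j * coeff p j) ≡ Σ< (suc n) (λ j → g j * coeff p j)
Σ<-length-degree n p g bound with ℕP.≤-total (length p) (suc n)
... | inj₁ len≤1+n = sym (Σ<-vanishing _ len≤1+n λ j len≤j _ →
        trans (cong (g j *_) (coeff-length p len≤j)) (ℤP.*-zeroʳ (g j)))
... | inj₂ 1+n≤len = Σ<-vanishing _ 1+n≤len λ j n<j _ →
        trans (cong (g j *_) (bound j n<j)) (ℤP.*-zeroʳ (g j))

coeff-∘ₚX+1-top : ∀ n k p → k ≤ n → DegreeAtMost n p →
  coeff (p ∘ₚ X+1) (n ∸ k) ≡ Σ< (suc k) (λ i → + ((n ∸ i) C (n ∸ k)) * coeff p (n ∸ i))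
coeff-∘ₚX+1-top n k p k≤n bound = begin
  coeff (p ∘ₚ X+1) (n ∸ k)                 ≡⟨ coeff-∘ₚX+1 p (n ∸ k) ⟩
  Σ< (length p) f                          ≡⟨ Σ<-length-degree n p (λ j → + (j C (n ∸ k))) bound ⟩
  Σ< (suc n) f                             ≡⟨ Σ<-reverse (suc n) f ⟩
  Σ< (suc n) (λ i → f (n ∸ i))             ≡⟨ Σ<-vanishing (λ i → f (n ∸ i)) (s≤s k≤n) binomial-vanishes ⟩
  Σ< (suc k) (λ i → f (n ∸ i))             ∎
  where
  open ≡-Reasoning
  f : ℕ → ℤ
  f j = + (j C (n ∸ k)) * coeff p j
  binomial-vanishes : ∀ i → suc k ≤ i → i < suc n → f (n ∸ i) ≡ 0ℤ
  binomial-vanishes i k<i (s≤s i≤n) =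
    cong (λ b → + b * coeff p (n ∸ i)) (k>n⇒nCk≡0 (ℕP.∸-monoʳ-< k<i i≤n))

i≡-i⇒i≡0 : ∀ {i} → i ≡ - i → i ≡ 0ℤ
i≡-i⇒i≡0 {+ zero}    _  = refl
i≡-i⇒i≡0 {+ (suc n)} ()
i≡-i⇒i≡0 { -[1+ n ]} ()

-1^m*i≡0⇒i≡0 : ∀ m {i} → (- 1ℤ) ^ℤ m * i ≡ 0ℤ → i ≡ 0ℤ
-1^m*i≡0⇒i≡0 m eq with ℤP.i*j≡0⇒i≡0∨j≡0 ((- 1ℤ) ^ℤ m) eq
... | inj₁ -1^m≡0 with ℤP.i^n≡0⇒i≡0 (- 1ℤ) m -1^m≡0
...   | ()
-1^m*i≡0⇒i≡0 m eq | inj₂ i≡0 = i≡0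

-1^odd : ∀ j → (- 1ℤ) ^ℤ suc (2 *ℕ j) ≡ - 1ℤ
-1^odd j = cong (- 1ℤ *_) (trans (sym (ℤP.^-*-assoc (- 1ℤ) 2 j)) (ℤP.^-zeroˡ j))

parity-coeff-vanishes : ∀ {n k} p m → p ∘ₚ negₚ Xₚ ≈ signₚ n p → Odd k → n ≡ m +ℕ k → coeff p m ≡ 0ℤ
parity-coeff-vanishes p m reflect (j , refl) refl = -1^m*i≡0⇒i≡0 m (i≡-i⇒i≡0 (begin
  s * coeff p m                                  ≡⟨ coeff-∘ₚ-X p m ⟨
  coeff (p ∘ₚ negₚ Xₚ) m                         ≡⟨ coeff-≈ reflect m ⟩
  coeff (signₚ (m +ℕ suc (2 *ℕ j)) p) m         ≡⟨ coeff-signₚ (m +ℕ suc (2 *ℕ j)) p m ⟩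
  (- 1ℤ) ^ℤ (m +ℕ suc (2 *ℕ j)) * coeff p m     ≡⟨ cong (_* coeff p m) (ℤP.^-distribˡ-+-* (- 1ℤ) m _) ⟩
  s * (- 1ℤ) ^ℤ suc (2 *ℕ j) * coeff p m        ≡⟨ cong (λ t → s * t * coeff p m) (-1^odd j) ⟩
  s * - 1ℤ * coeff p m                           ≡⟨ sign-flip s (coeff p m) ⟩
  - (s * coeff p m)                              ∎))
  where
  open ≡-Reasoning
  s = (- 1ℤ) ^ℤ m
  sign-flip : ∀ s c → s * - 1ℤ * c ≡ - (s * c)
  sign-flip = ℤ-solve

charMatrix-∘ₚ : ∀ {n} (M : Mat n) r i j →
  charMatrix M i j ∘ₚ r ≈ (constₚ (δ i j) *ₚ r) +ₚ negₚ (constₚ (M i j))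
charMatrix-∘ₚ M r i j = ≈-trans (∘ₚ-+ₚ r (constₚ (δ i j) *ₚ Xₚ) (negₚ (constₚ (M i j))))
  (+ₚ-cong (≈-trans (∘ₚ-*ₚ r (constₚ (δ i j)) Xₚ) (*-cong (∘ₚ-constₚ r (δ i j)) (∘ₚ-X r)))
           (≈-trans (∘ₚ-negₚ r (constₚ (M i j))) (negₚ-cong (∘ₚ-constₚ r (M i j)))))

charPoly-∘ₚX+1 : ∀ {n} (M : Mat n) → Char M ∘ₚ X+1 ≈ Char (subI M)
charPoly-∘ₚX+1 M = ≈-trans (det-homo (∘ₚ-isRingHomomorphism X+1) (charMatrix M)) (det-cong λ i j →
  ≈-trans (charMatrix-∘ₚ M X+1 i j) (shift (constₚ (δ i j)) Xₚ (constₚ (M i j))))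
  where
  shift : ∀ d x m → (d *ₚ (x +ₚ constₚ 1ℤ)) +ₚ negₚ m ≈ (d *ₚ x) +ₚ negₚ (m +ₚ negₚ d)
  shift = solve-∀ polyAlmostCommRing

charPoly-reflect : ∀ {n} (S : Mat n) → SkewSymmetric S → Char S ∘ₚ negₚ Xₚ ≈ signₚ n (Char S)
charPoly-reflect {n} S skew = begin
  Char S ∘ₚ negₚ Xₚ                          ≈⟨ det-homo (∘ₚ-isRingHomomorphism (negₚ Xₚ)) (charMatrix S) ⟩
  det (λ i j → charMatrix S i j ∘ₚ negₚ Xₚ)   ≈⟨ det-cong reflect-entry ⟩
  det (λ i j → negₚ ((charMatrix S ᵀ) i j))  ≈⟨ det-negate (charMatrix S ᵀ) ⟩
  signₚ n (det (charMatrix S ᵀ))              ≈⟨ signₚ-cong n (det-transpose (charMatrix S)) ⟩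
  signₚ n (Char S)                            ∎
  where
  open ≈-Reasoning
  flip : ∀ d x s → (d *ₚ negₚ x) +ₚ negₚ s ≈ negₚ ((d *ₚ x) +ₚ negₚ (negₚ s))
  flip = solve-∀ polyAlmostCommRing
  reflect-entry : ∀ i j → charMatrix S i j ∘ₚ negₚ Xₚ ≈ negₚ (charMatrix S j i)
  reflect-entry i j = ≈-trans (charMatrix-∘ₚ S (negₚ Xₚ) i j)
    (≈-trans (flip (constₚ (δ i j)) Xₚ (constₚ (S i j)))
             (negₚ-cong (+ₚ-cong (*ₚ-congʳ Xₚ (∷-cong {p = []} (δ-sym i j) ≈-refl))
                                 (negₚ-cong (∷-cong {p = []} (sym (skew i j)) ≈-refl)))))

Σ<-binomial-last : ∀ {n k} (x : ℕ → ℤ) → k < n →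
  Σ< (suc k) (λ i → + ((n ∸ i) C (n ∸ suc k)) * x i) ≡
  + (n ∸ suc k +ℕ 1) * x k + Σ< k (λ i → + ((n ∸ i) C (n ∸ suc k)) * x i)
Σ<-binomial-last {n} {k} x k<n =
  trans (ℤP.+-comm (Σ< k f) (f k)) (cong (λ b → + b * x k + Σ< k f) last)
  where
  open ≡-Reasoning
  a = n ∸ suc k
  f : ℕ → ℤ
  f i = + ((n ∸ i) C a) * x i
  last : (n ∸ k) C a ≡ a +ℕ 1
  last = begin
    (n ∸ k) C a          ≡⟨ cong (_C a) (ℕP.+-∸-assoc 1 k<n) ⟩
    suc a C a            ≡⟨ nCk≡nC[n∸k] (ℕP.n≤1+n a) ⟩
    suc a C (suc a ∸ a)  ≡⟨ cong (suc a C_) (ℕP.m+n∸n≡m 1 a) ⟩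
    suc a C 1            ≡⟨ nC1≡n (suc a) ⟩
    suc a                ≡⟨ ℕP.+-comm 1 a ⟩
    a +ℕ 1               ∎

charPoly-binomialSum : ∀ {n} (M : Mat n) → SkewSymmetric (subI M) →
  ∀ k → Odd k → k ≤ n → Σ< k (λ i → + ((n ∸ i) C (n ∸ k)) * c i (Char M)) + c k (Char M) ≡ 0ℤ
charPoly-binomialSum {n} M skew k k-odd k≤n = begin
  Σ< k (λ i → + ((n ∸ i) C (n ∸ k)) * c i (Char M)) + c k (Char M)
    ≡⟨ cong₂ _+_ (Σ<-cong k λ i _ → cong (+ ((n ∸ i) C (n ∸ k)) *_) (c-charPoly M i))
                 (trans (c-charPoly M k) (sym last-term)) ⟩
  Σ< (suc k) (λ i → + ((n ∸ i) C (n ∸ k)) * coeff (Char M) (n ∸ i))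
    ≡⟨ coeff-∘ₚX+1-top n k (Char M) k≤n (proj₁ (charPoly-monic M)) ⟨
  coeff (Char M ∘ₚ X+1) (n ∸ k)
    ≡⟨ coeff-≈ (charPoly-∘ₚX+1 M) (n ∸ k) ⟩
  coeff (Char (subI M)) (n ∸ k)
    ≡⟨ parity-coeff-vanishes (Char (subI M)) (n ∸ k) (charPoly-reflect (subI M) skew) k-odd
                             (sym (ℕP.m∸n+n≡m k≤n)) ⟩
  0ℤ ∎
  where
  open ≡-Reasoning
  last-term : + ((n ∸ k) C (n ∸ k)) * coeff (Char M) (n ∸ k) ≡ coeff (Char M) (n ∸ k)
  last-term = trans (cong (λ b → + b * coeff (Char M) (n ∸ k)) (nCn≡1 (n ∸ k))) (ℤP.*-identityˡ _)

charPoly-c-divisible : ∀ {n} (M : Mat n) → ±1-Entries M →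
  ∀ k → 1 ≤ k → k ≤ n → two^ (k ∸ 1) DS.∣ c k (Char M)
charPoly-c-divisible {suc n} M ±1 (suc k) _ (s≤s k≤n) =
  subst₂ (λ e x → two^ e DS.∣ x) (ℕP.m∸[m∸n]≡n k≤n) (sym (c-charPoly M (suc k)))
         (charPoly-∈⟨2,X⟩^ M ±1 (n ∸ k))

lemma2p4 : (n : ℕ) (M : Mat n) → InT n M →
    ((k : ℕ) → Odd k → 1 ≤ k → k ≤ n →
      c k (Char M) ≡ - Σ< k (λ i → + ((n ∸ i) C (n ∸ k)) * c i (Char M)))
    ×
    (Odd n → (k : ℕ) → Odd k → 1 ≤ k → k ≤ n →
      (+ (2 ^ (k ∸ 1))) ∣
        ((+ (n ∸ k +ℕ 1)) * c (k ∸ 1) (Char M)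
          + Σ< (k ∸ 1) (λ i → + ((n ∸ i) C (n ∸ k)) * c i (Char M))))
lemma2p4 n M (±1 , _ , skew) = recurrence , divisibility
  where
  sum : ℕ → ℕ → ℤ
  sum k l = Σ< l (λ i → + ((n ∸ i) C (n ∸ k)) * c i (Char M))

  recurrence : ∀ k → Odd k → 1 ≤ k → k ≤ n → c k (Char M) ≡ - sum k k
  recurrence k k-odd _ k≤n = ℤ-inverseʳ-unique (sum k k) _ (charPoly-binomialSum M skew k k-odd k≤n)

  -- 2^(k−1) divides c_k(Char M) for every n.
  divisibility : Odd n → ∀ k → Odd k → 1 ≤ k → k ≤ n →
    + (2 ^ (k ∸ 1)) ∣ (+ (n ∸ k +ℕ 1)) * c (k ∸ 1) (Char M) + sum k (k ∸ 1)
  divisibility _ (suc k) k-odd 1≤k k<n = DS.∣⇒∣ᵤ (subst (two^ k DS.∣_)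
    (trans (sym (ℤ-inverseˡ-unique _ _ (charPoly-binomialSum M skew (suc k) k-odd k<n)))
           (Σ<-binomial-last (λ i → c i (Char M)) k<n))
    (DS.∣m⇒∣-m (charPoly-c-divisible M ±1 (suc k) 1≤k k<n)))
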